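{- In the Coxeter group $D_n$, for every reflection $t\in T$ and every $r\in D(t)\setminus\{t\}$ we have $r\prec t$.
   Context: $D_n$: signed permutations of $\{\pm1,\dots,\pm n\}$ with an even number of negative entries, with reflections $s_{i,j}$, $t_{i,j}$ ($i<j$) whose positive roots in $\mathbb R^n$ are $e_i-e_j$ and $-e_i-e_j$ respectively, and simple roots $e_k-e_{k+1}$ ($1\le k\le n-1$) and $-e_1-e_2$. $r\preceq t$ iff the positive root of $t$ minus that of $r$ is a nonnegative combination of simple roots; $r\prec t$ means $r\preceq t$ and $r\neq t$. $D(t)=\{r\in T: tr<t\}$ (Bruhat order). -}

module Defs where

open import Data.Nat as ℕ using (ℕ; zero; suc)
open import Data.Fin as Fin using (Fin; zero; suc; inject₁; _≟_)
open import Data.Bool using (Bool; true; false; _xor_; if_then_else_)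
open import Data.Product using (_×_; _,_; Σ; ∃; ∃-syntax)
open import Data.Vec using (Vec; tabulate; lookup)
open import Data.List using (List; []; _∷_; length)
open import Data.Integer as ℤ using (ℤ; +_; -_; _+_; _-_; _*_)
open import Relation.Nullary.Decidable using (⌊_⌋)
open import Relation.Binary.PropositionalEquality using (_≡_; _≢_)
open import Relation.Binary.Construct.Closure.Transitive using (TransClosure)

-- Signed permutations of {±1,…,±n} (window notation).
-- A signed value is (negative?, absolute value), absolute values 0-indexed.

SVal : ℕ → Set
SVal n = Bool × Fin n

SPerm : ℕ → Set
SPerm n = Vec (SVal n) n

apply : ∀ {n} → SPerm n → SVal n → SVal n
apply w (b , j) with lookup w j
... | (c , k) = (b xor c , k)

_·_ : ∀ {n} → SPerm n → SPerm n → SPerm n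
u · v = tabulate λ i → apply u (lookup v i)

idP : ∀ {n} → SPerm n
idP = tabulate λ i → (false , i)

sPerm : ∀ {n} → Fin n → Fin n → SPerm n
sPerm i j = tabulate λ k →
  if ⌊ k ≟ i ⌋ then (false , j) else if ⌊ k ≟ j ⌋ then (false , i) else (false , k)

tPerm : ∀ {n} → Fin n → Fin n → SPerm n
tPerm i j = tabulate λ k →
  if ⌊ k ≟ i ⌋ then (true , j) else if ⌊ k ≟ j ⌋ then (true , i) else (false , k)

-- The Coxeter group D_n, n = m + 2, with simple generators indexed by
-- Fin n: index 0 is s₀ = t_{1,2} (root −e₁−e₂), index k+1 is
-- s_{k+1} = s_{k+1,k+2} (root e_{k+1} − e_{k+2}).

simpleGen : ∀ {m} → Fin (suc (suc m)) → SPerm (suc (suc m))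
simpleGen zero    = tPerm zero (suc zero)
simpleGen (suc k) = sPerm (inject₁ k) (suc k)

evalWord : ∀ {m} → List (Fin (suc (suc m))) → SPerm (suc (suc m))
evalWord []       = idP
evalWord (s ∷ ws) = simpleGen s · evalWord ws

IsWord : ∀ {m} → SPerm (suc (suc m)) → List (Fin (suc (suc m))) → Set
IsWord w ws = evalWord ws ≡ w

-- ℓ(u) < ℓ(w), where ℓ is the Coxeter length (minimal word length):
-- every word for w is strictly longer than some word for u.
LengthLt : ∀ {m} → SPerm (suc (suc m)) → SPerm (suc (suc m)) → Set
LengthLt u w = ∀ ws → IsWord w ws → ∃[ us ] (IsWord u us × length us ℕ.< length ws)

data Refl (n : ℕ) : Set where
  sR : (i j : Fin n) → i Fin.< j → Refl n
  tR : (i j : Fin n) → i Fin.< j → Refl n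

reflPerm : ∀ {n} → Refl n → SPerm n
reflPerm (sR i j _) = sPerm i j
reflPerm (tR i j _) = tPerm i j

-- vectors in ℤⁿ (⊆ ℝⁿ; all roots have integer coordinates)
e : ∀ {n} → Fin n → Fin n → ℤ
e i k = if ⌊ k ≟ i ⌋ then + 1 else + 0

root : ∀ {n} → Refl n → Fin n → ℤ
root (sR i j _) k = e i k - e j k
root (tR i j _) k = - e i k - e j k

simpleRoot : ∀ {m} → Fin (suc (suc m)) → Fin (suc (suc m)) → ℤ
simpleRoot zero    x = - e zero x - e (suc zero) x
simpleRoot (suc k) x = e (inject₁ k) x - e (suc k) x

sumFin : ∀ {n} → (Fin n → ℤ) → ℤ
sumFin {zero}  f = + 0
sumFin {suc n} f = f zero + sumFin (λ k → f (suc k))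

-- v is a nonnegative (integer) combination of the simple roots.
-- (Simple roots are a basis and positive-root differences are integral,
-- so nonnegative real coefficients are automatically integers.)
NonnegSimple : ∀ {m} → (Fin (suc (suc m)) → ℤ) → Set
NonnegSimple {m} v =
  Σ (Fin (suc (suc m)) → ℕ) λ c → (∀ x → sumFin (λ k → (+ c k) * simpleRoot k x) ≡ v x)

_⪯_ : ∀ {m} → Refl (suc (suc m)) → Refl (suc (suc m)) → Set
r ⪯ t = NonnegSimple (λ x → root t x - root r x)

_≺_ : ∀ {m} → Refl (suc (suc m)) → Refl (suc (suc m)) → Set
r ≺ t = r ⪯ t × r ≢ t

data BruhatStep {m} (u w : SPerm (suc (suc m))) : Set where
  step : (t' : Refl (suc (suc m))) → w ≡ u · reflPerm t' → LengthLt u w → BruhatStep u w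

_<B_ : ∀ {m} → SPerm (suc (suc m)) → SPerm (suc (suc m)) → Set
_<B_ {m} = TransClosure (BruhatStep {m})

InD : ∀ {m} → Refl (suc (suc m)) → Refl (suc (suc m)) → Set
InD t r = (reflPerm t · reflPerm r) <B reflPerm t

module Submission where

-- Write a signed permutation w in window notation, with entries ±(|w(a)| + 1). The statistic
-- twiceInv counts, twice, the pairs of positions a < b with w a > w b or w a + w b < 0; it is at
-- most twice the length of any word for w, since right multiplication by a simple generator
-- changes it by at most 2, and it equals twice the length of an explicit word for each reflection.
-- Right multiplication by a reflection r changes only two window entries, and the change of
-- twiceInv is a sum of sign terms over the remaining positions. When r is an ascent of t
-- (t(k) < t(l) for r = s_{k,l}, t(k) + t(l) > 0 for r = t_{k,l}) all these terms are nonnegative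
-- and twiceInv grows by at least 2, which is impossible if r ∈ D(t), because then t r has a word
-- shorter than the reduced word of t. Finally, a case analysis shows that every reflection r ≠ t
-- that is not an ascent of t lies below t: the difference of the two positive roots is again a
-- positive root.

open import Defs
open import Data.Nat as ℕ using (ℕ; zero; suc)
import Data.Nat.Properties as ℕP
open import Data.Fin as Fin using (Fin; zero; suc; inject₁; toℕ; _≟_)
import Data.Fin.Properties as FinP
open import Data.Integer as ℤ using (ℤ; +_; -_; _+_; _-_; _*_; -[1+_]; +[1+_]; +0; +≤+; -≤+; +<+)
import Data.Integer.Properties as ℤP
open import Data.Integer.Tactic.RingSolver using (solve-∀)
open import Data.Bool using (Bool; true; false; if_then_else_)
open import Data.Bool.Properties using (xor-assoc; xor-identityʳ)
open import Data.Empty using (⊥; ⊥-elim)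
open import Data.Sum using (_⊎_; inj₁; inj₂)
open import Data.Product using (_×_; _,_; proj₁; proj₂; Σ-syntax)
open import Data.Vec using (Vec; lookup; tabulate)
open import Data.Vec.Properties using (lookup∘tabulate; tabulate∘lookup; tabulate-cong)
open import Data.List using (List; []; _∷_; _++_; [_]; length)
import Data.List.Properties as ListP
open import Data.Vec.Functional using (updateAt)
open import Data.Vec.Functional.Properties using (updateAt-updates; updateAt-minimal)
open import Function using (const; _∘_)
open import Relation.Nullary using (¬_; yes; no)
open import Relation.Nullary.Decidable using (⌊_⌋; isYes≗does; dec-true; dec-false)
open import Relation.Binary.Definitions using (Tri; tri<; tri≈; tri>)
import Relation.Binary.Construct.Closure.Transitive as Transitive
open import Relation.Binary.PropositionalEquality hiding ([_])
open import Algebra.Properties.CommutativeMonoid.Sum ℤP.+-0-commutativeMonoid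
  using (sum; sum-cong-≗; ∑-distrib-+; sum-replicate-zero)
open import Algebra.Properties.Semiring.Sum ℤP.+-*-semiring using (*-distribˡ-sum)

private
  variable
    n : ℕ
    f g : Fin n → ℤ

sumFin≡sum : (f : Fin n → ℤ) → sumFin f ≡ sum f
sumFin≡sum {zero}  f = refl
sumFin≡sum {suc n} f = cong (λ s → f zero + s) (sumFin≡sum (λ a → f (suc a)))

sum-zero : (∀ a → f a ≡ + 0) → sum f ≡ + 0
sum-zero {n} f≗0 = trans (sum-cong-≗ f≗0) (sum-replicate-zero n)

sum-mono-≤ : (∀ a → f a ℤ.≤ g a) → sum f ℤ.≤ sum g
sum-mono-≤ {zero}  f≤g = ℤP.≤-refl
sum-mono-≤ {suc n} f≤g = ℤP.+-mono-≤ (f≤g zero) (sum-mono-≤ (λ a → f≤g (suc a)))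

sum-sub : (f g : Fin n → ℤ) → sum (λ a → f a - g a) ≡ sum f - sum g
sum-sub f g = trans (∑-distrib-+ f (λ a → - g a)) (cong (λ s → sum f + s) (sum-neg g))
  where
  sum-neg : ∀ {n} (g : Fin n → ℤ) → sum (λ a → - g a) ≡ - sum g
  sum-neg {zero}  g = refl
  sum-neg {suc n} g = trans (cong (λ s → - g zero + s) (sum-neg (λ a → g (suc a))))
                            (sym (ℤP.neg-distrib-+ (g zero) _))

sum-erase : (f : Fin n → ℤ) (k : Fin n) → sum f ≡ sum (updateAt f k (const (+ 0))) + f k
sum-erase {suc n} f zero    =
  trans (ℤP.+-comm (f zero) _) (cong (_+ f zero) (sym (ℤP.+-identityˡ (sum (λ a → f (suc a))))))
sum-erase {suc n} f (suc k) = trans (cong (λ s → f zero + s) (sum-erase (λ a → f (suc a)) k))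
                                    (sym (ℤP.+-assoc (f zero) _ _))

erase₂ : Fin n → Fin n → (Fin n → ℤ) → Fin n → ℤ
erase₂ k l f = updateAt (updateAt f k (const (+ 0))) l (const (+ 0))

module _ {k l : Fin n} (k≢l : k ≢ l) where

  sum-erase₂ : (f : Fin n → ℤ) → sum f ≡ sum (erase₂ k l f) + f k + f l
  sum-erase₂ f = begin
    sum f                                          ≡⟨ sum-erase f k ⟩
    sum (updateAt f k _) + f k                     ≡⟨ cong (_+ f k) (sum-erase (updateAt f k _) l) ⟩
    sum (erase₂ k l f) + updateAt f k _ l + f k    ≡⟨ cong (λ s → sum (erase₂ k l f) + s + f k)
                                                           (updateAt-minimal l k f (k≢l ∘ sym)) ⟩
    sum (erase₂ k l f) + f l + f k                 ≡⟨ swap-last (sum (erase₂ k l f)) (f l) (f k) ⟩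
    sum (erase₂ k l f) + f k + f l                 ∎
    where
    open ≡-Reasoning
    swap-last : ∀ s a b → s + a + b ≡ s + b + a
    swap-last = solve-∀

  erase₂-left : erase₂ k l f k ≡ + 0
  erase₂-left {f = f} = trans (updateAt-minimal k l _ k≢l) (updateAt-updates k f)

  erase₂-right : erase₂ k l f l ≡ + 0
  erase₂-right = updateAt-updates l _

  erase₂-outside : ∀ {a} → a ≢ k → a ≢ l → erase₂ k l f a ≡ f a
  erase₂-outside {f = f} a≢k a≢l = trans (updateAt-minimal _ l _ a≢l) (updateAt-minimal _ k f a≢k)

  erase₂-cases : (P : ℤ → Set) → P (+ 0) → (∀ a → a ≢ k → a ≢ l → P (f a)) →
                 ∀ a → P (erase₂ k l f a)
  erase₂-cases {f = f} P P0 Pf a with a ≟ k | a ≟ l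
  ... | yes refl | _        = subst P (sym erase₂-left) P0
  ... | no _     | yes refl = subst P (sym erase₂-right) P0
  ... | no a≢k   | no a≢l   = subst P (sym (erase₂-outside a≢k a≢l)) (Pf a a≢k a≢l)

  erase₂-cong : (∀ a → a ≢ k → a ≢ l → f a ≡ g a) → ∀ a → erase₂ k l f a ≡ erase₂ k l g a
  erase₂-cong f≡g a with a ≟ k | a ≟ l
  ... | yes refl | _        = trans erase₂-left (sym erase₂-left)
  ... | no _     | yes refl = trans erase₂-right (sym erase₂-right)
  ... | no a≢k   | no a≢l   = trans (erase₂-outside a≢k a≢l)
                                    (trans (f≡g a a≢k a≢l) (sym (erase₂-outside a≢k a≢l)))

  -- A symmetric kernel vanishing off the rows and columns k, l: each of its entries outside
  -- the (k, l) block occurs once in a row k or l and once in a column k or l.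
  module _ (Δ : Fin n → Fin n → ℤ) (Δ-sym : ∀ a b → Δ a b ≡ Δ b a) (Δ-diag : ∀ a → Δ a a ≡ + 0)
           (Δ-off : ∀ a b → a ≢ k → a ≢ l → b ≢ k → b ≢ l → Δ a b ≡ + 0) where

    private
      R : Fin n → ℤ
      R a = Δ k a + Δ l a

      row-outside : ∀ a → a ≢ k → a ≢ l → sum (Δ a) ≡ Δ k a + Δ l a
      row-outside a a≢k a≢l = begin
        sum (Δ a)                                ≡⟨ sum-erase₂ (Δ a) ⟩
        sum (erase₂ k l (Δ a)) + Δ a k + Δ a l   ≡⟨ cong (λ s → s + Δ a k + Δ a l)
                                                      (sum-zero (erase₂-cases (_≡ + 0) refl
                                                        (λ b → Δ-off a b a≢k a≢l))) ⟩
        + 0 + Δ a k + Δ a l                      ≡⟨ cong (_+ Δ a l) (ℤP.+-identityˡ (Δ a k)) ⟩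
        Δ a k + Δ a l                            ≡⟨ cong₂ _+_ (Δ-sym a k) (Δ-sym a l) ⟩
        Δ k a + Δ l a                            ∎
        where open ≡-Reasoning

    sum-sum-twoPoint : sum (λ a → sum (Δ a)) ≡ + 2 * (sum (erase₂ k l (λ a → Δ k a + Δ l a)) + Δ k l)
    sum-sum-twoPoint = begin
      sum (λ a → sum (Δ a))                                ≡⟨ sum-erase₂ (λ a → sum (Δ a)) ⟩
      sum (erase₂ k l (λ a → sum (Δ a))) + sum (Δ k) + sum (Δ l)
                                                           ≡⟨ cong (λ s → s + sum (Δ k) + sum (Δ l))
                                                                (sum-cong-≗ (erase₂-cong row-outside)) ⟩
      S + sum (Δ k) + sum (Δ l)                            ≡⟨ ℤP.+-assoc S _ _ ⟩
      S + (sum (Δ k) + sum (Δ l))                          ≡⟨ cong (λ s → S + s) (sym (∑-distrib-+ (Δ k) (Δ l))) ⟩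
      S + sum R                                            ≡⟨ cong (λ s → S + s) (sum-erase₂ R) ⟩
      S + (S + R k + R l)                                  ≡⟨ cong₂ (λ r r′ → S + (S + r + r′)) R-left R-right ⟩
      S + (S + Δ k l + Δ k l)                              ≡⟨ double S (Δ k l) ⟩
      + 2 * (S + Δ k l)                                    ∎
      where
      open ≡-Reasoning
      S = sum (erase₂ k l R)
      R-left : R k ≡ Δ k l
      R-left = trans (cong (_+ Δ l k) (Δ-diag k)) (trans (ℤP.+-identityˡ _) (Δ-sym l k))
      R-right : R l ≡ Δ k l
      R-right = trans (cong (λ s → Δ k l + s) (Δ-diag l)) (ℤP.+-identityʳ _)
      double : ∀ s d → s + (s + d + d) ≡ + 2 * (s + d)
      double = solve-∀

χ⁺ : ℤ → ℤ
χ⁺ +[1+ _ ] = + 1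
χ⁺ _        = + 0

signum : ℤ → ℤ
signum p = χ⁺ p - χ⁺ (- p)

χ⁺-nonpos : ∀ {p} → p ℤ.≤ + 0 → χ⁺ p ≡ + 0
χ⁺-nonpos {+0}       _         = refl
χ⁺-nonpos { -[1+ _ ]} _        = refl
χ⁺-nonpos {+[1+ _ ]} (+≤+ ())

m<n⇒0<n-m : ∀ {m n} → m ℤ.< n → + 0 ℤ.< n - m
m<n⇒0<n-m {m} {n} m<n = subst (ℤ._< n - m) (ℤP.+-inverseʳ m) (ℤP.+-monoˡ-< (- m) m<n)

signum-pos : ∀ {p} → + 0 ℤ.< p → signum p ≡ + 1
signum-pos {+[1+ _ ]} _       = refl
signum-pos {+0}       (+<+ ())

signum≤1 : ∀ p → signum p ℤ.≤ + 1
signum≤1 +0         = +≤+ ℕ.z≤n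
signum≤1 +[1+ _ ]   = ℤP.≤-refl
signum≤1 -[1+ _ ]   = -≤+

signum-sum-nonneg : ∀ p q → + 0 ℤ.< p + q → + 0 ℤ.≤ signum p + signum q
signum-sum-nonneg (+ m)      (+ m′)      _  = ℤP.+-mono-≤ (nonneg m) (nonneg m′)
  where
  nonneg : ∀ m → + 0 ℤ.≤ signum (+ m)
  nonneg zero    = ℤP.≤-refl
  nonneg (suc _) = +≤+ ℕ.z≤n
signum-sum-nonneg -[1+ _ ]   +[1+ _ ]    _  = ℤP.≤-refl
signum-sum-nonneg +[1+ _ ]   -[1+ _ ]    _  = ℤP.≤-refl
signum-sum-nonneg -[1+ _ ]   +0          ()
signum-sum-nonneg -[1+ _ ]   -[1+ _ ]    ()
signum-sum-nonneg +0         -[1+ _ ]    ()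

-- Positions a < b carrying the values u, v form [u > v] + [u + v < 0] inversions of D_n.
dInv : ℤ → ℤ → ℤ
dInv u v = χ⁺ (u - v) + χ⁺ (- (u + v))

dInv-negˡ : ∀ u v → dInv (- u) v ≡ dInv u v
dInv-negˡ u v = begin
  χ⁺ (- u - v) + χ⁺ (- (- u + v))  ≡⟨ cong₂ (λ p q → χ⁺ p + χ⁺ q) (neg-sum u v) (neg-diff u v) ⟩
  χ⁺ (- (u + v)) + χ⁺ (u - v)      ≡⟨ ℤP.+-comm _ (χ⁺ (u - v)) ⟩
  dInv u v                         ∎
  where
  open ≡-Reasoning
  neg-sum : ∀ u v → - u - v ≡ - (u + v)
  neg-sum = solve-∀
  neg-diff : ∀ u v → - (- u + v) ≡ u - v
  neg-diff = solve-∀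

dInv-antisym : ∀ u v → dInv u v ≡ dInv v u + signum (u - v)
dInv-antisym u v = begin
  χ⁺ (u - v) + χ⁺ (- (u + v))                                      ≡⟨ rearrange (χ⁺ (u - v)) _ (χ⁺ (- (u - v))) ⟩
  χ⁺ (- (u - v)) + χ⁺ (- (u + v)) + (χ⁺ (u - v) - χ⁺ (- (u - v)))  ≡⟨ cong₂ (λ p q → χ⁺ p + χ⁺ q + signum (u - v))
                                                                        (flip u v) (cong -_ (ℤP.+-comm u v)) ⟩
  dInv v u + signum (u - v)                                        ∎
  where
  open ≡-Reasoning
  rearrange : ∀ a b c → a + b ≡ c + b + (a - c)
  rearrange = solve-∀
  flip : ∀ u v → - (u - v) ≡ v - u
  flip = solve-∀

dInv-negʳ : ∀ u v → dInv u (- v) ≡ dInv v u + signum (u + v)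
dInv-negʳ u v = trans (dInv-antisym u (- v)) (cong₂ _+_ (dInv-negˡ v u) (cong signum (minus-neg u v)))
  where
  minus-neg : ∀ u v → u - - v ≡ u + v
  minus-neg = solve-∀

dInv-ascending : ∀ {u v} → u ℤ.< v → + 0 ℤ.< u + v → dInv u v ≡ + 0
dInv-ascending u<v 0<u+v =
  cong₂ _+_ (χ⁺-nonpos (ℤP.i≤j⇒i-j≤0 (ℤP.<⇒≤ u<v))) (χ⁺-nonpos (ℤP.neg-mono-≤ (ℤP.<⇒≤ 0<u+v)))

-- The inversion statistic and its change under two-point updates

pairInv : Fin n → Fin n → ℤ → ℤ → ℤ
pairInv a b u v with FinP.<-cmp a b
... | tri< _ _ _ = dInv u v
... | tri≈ _ _ _ = + 0
... | tri> _ _ _ = dInv v u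

-- Summing pairInv over all ordered pairs counts each D_n-inversion twice.
twiceInv : (Fin n → ℤ) → ℤ
twiceInv f = sum (λ a → sum (λ b → pairInv a b (f a) (f b)))

module _ {a b : Fin n} {u v : ℤ} where

  pairInv-< : a Fin.< b → pairInv a b u v ≡ dInv u v
  pairInv-< a<b with FinP.<-cmp a b
  ... | tri< _ _ _    = refl
  ... | tri≈ a≮b _ _  = ⊥-elim (a≮b a<b)
  ... | tri> a≮b _ _  = ⊥-elim (a≮b a<b)

  pairInv-> : b Fin.< a → pairInv a b u v ≡ dInv v u
  pairInv-> b<a with FinP.<-cmp a b
  ... | tri< _ _ b≮a  = ⊥-elim (b≮a b<a)
  ... | tri≈ _ _ b≮a  = ⊥-elim (b≮a b<a)
  ... | tri> _ _ _    = refl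

pairInv-diag : (a : Fin n) {u v : ℤ} → pairInv a a u v ≡ + 0
pairInv-diag a with FinP.<-cmp a a
... | tri< a<a _ _ = ⊥-elim (FinP.<-irrefl refl a<a)
... | tri≈ _ _ _   = refl
... | tri> _ _ a<a = ⊥-elim (FinP.<-irrefl refl a<a)

pairInv-sym : (a b : Fin n) (u v : ℤ) → pairInv a b u v ≡ pairInv b a v u
pairInv-sym a b u v with FinP.<-cmp a b
... | tri< a<b _ _  = sym (pairInv-> a<b)
... | tri≈ _ refl _ = sym (pairInv-diag a)
... | tri> _ _ b<a  = sym (pairInv-< b<a)

update₂ : (Fin n → ℤ) → Fin n → Fin n → ℤ → ℤ → Fin n → ℤ
update₂ f k l x y = updateAt (updateAt f k (const x)) l (const y)

module _ {k l : Fin n} (k≢l : k ≢ l) {f : Fin n → ℤ} {x y : ℤ} where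

  update₂-left : update₂ f k l x y k ≡ x
  update₂-left = trans (updateAt-minimal k l _ k≢l) (updateAt-updates k f)

  update₂-right : update₂ f k l x y l ≡ y
  update₂-right = updateAt-updates l _

  update₂-outside : ∀ {a} → a ≢ k → a ≢ l → update₂ f k l x y a ≡ f a
  update₂-outside a≢k a≢l = trans (updateAt-minimal _ l _ a≢l) (updateAt-minimal _ k f a≢k)

module Update₂ {k l : Fin n} (k<l : k Fin.< l) (f : Fin n → ℤ) (x y : ℤ) where

  private
    k≢l : k ≢ l
    k≢l = FinP.<⇒≢ k<l

  pairChange : Fin n → ℤ
  pairChange a = (pairInv k a x (f a) - pairInv k a (f k) (f a))
               + (pairInv l a y (f a) - pairInv l a (f l) (f a))

  twiceInv-update₂ : twiceInv (update₂ f k l x y)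
                   ≡ twiceInv f + + 2 * (sum (erase₂ k l pairChange) + (dInv x y - dInv (f k) (f l)))
  twiceInv-update₂ = begin
    twiceInv f′                                    ≡⟨ shift (twiceInv f′) (twiceInv f) ⟩
    twiceInv f + (twiceInv f′ - twiceInv f)        ≡⟨ cong (λ s → twiceInv f + s) difference ⟩
    twiceInv f + + 2 * (sum (erase₂ k l pairChange) + (dInv x y - dInv (f k) (f l)))  ∎
    where
    open ≡-Reasoning
    f′ = update₂ f k l x y
    Q : (Fin n → ℤ) → Fin n → Fin n → ℤ
    Q h a b = pairInv a b (h a) (h b)
    Δ : Fin n → Fin n → ℤ
    Δ a b = Q f′ a b - Q f a b
    shift : ∀ s t → s ≡ t + (s - t)
    shift = solve-∀
    Δ-sym : ∀ a b → Δ a b ≡ Δ b a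
    Δ-sym a b = cong₂ _-_ (pairInv-sym a b _ _) (pairInv-sym a b _ _)
    Δ-diag : ∀ a → Δ a a ≡ + 0
    Δ-diag a = cong₂ _-_ (pairInv-diag a) (pairInv-diag a)
    Δ-off : ∀ a b → a ≢ k → a ≢ l → b ≢ k → b ≢ l → Δ a b ≡ + 0
    Δ-off a b a≢k a≢l b≢k b≢l =
      trans (cong₂ (λ u v → pairInv a b u v - Q f a b) (update₂-outside k≢l a≢k a≢l) (update₂-outside k≢l b≢k b≢l))
            (ℤP.+-inverseʳ (Q f a b))
    Δ-row : ∀ a → a ≢ k → a ≢ l → Δ k a + Δ l a ≡ pairChange a
    Δ-row a a≢k a≢l = trans
      (cong₂ (λ p q → (pairInv k a p (f′ a) - Q f k a) + (pairInv l a q (f′ a) - Q f l a))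
             (update₂-left k≢l) (update₂-right k≢l))
      (cong (λ z → (pairInv k a x z - Q f k a) + (pairInv l a y z - Q f l a)) (update₂-outside k≢l a≢k a≢l))
    Δ-block : Δ k l ≡ dInv x y - dInv (f k) (f l)
    Δ-block = cong₂ _-_ (trans (pairInv-< k<l) (cong₂ dInv (update₂-left k≢l) (update₂-right k≢l))) (pairInv-< k<l)
    difference : twiceInv f′ - twiceInv f ≡ + 2 * (sum (erase₂ k l pairChange) + (dInv x y - dInv (f k) (f l)))
    difference = begin
      twiceInv f′ - twiceInv f                      ≡⟨ sym (sum-sub (λ a → sum (Q f′ a)) (λ a → sum (Q f a))) ⟩
      sum (λ a → sum (Q f′ a) - sum (Q f a))       ≡⟨ sum-cong-≗ (λ a → sym (sum-sub (Q f′ a) (Q f a))) ⟩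
      sum (λ a → sum (Δ a))                       ≡⟨ sum-sum-twoPoint k≢l Δ Δ-sym Δ-diag Δ-off ⟩
      + 2 * (sum (erase₂ k l (λ a → Δ k a + Δ l a)) + Δ k l)
                                                   ≡⟨ cong₂ (λ s t → + 2 * (s + t))
                                                        (sum-cong-≗ (erase₂-cong k≢l Δ-row)) Δ-block ⟩
      + 2 * (sum (erase₂ k l pairChange) + (dInv x y - dInv (f k) (f l)))  ∎

  module _ {a : Fin n} where

    pairChange-before : a Fin.< k → pairChange a
      ≡ (dInv (f a) x - dInv (f a) (f k)) + (dInv (f a) y - dInv (f a) (f l))
    pairChange-before a<k = cong₂ _+_
      (cong₂ _-_ (pairInv-> a<k) (pairInv-> a<k)) (cong₂ _-_ (pairInv-> a<l) (pairInv-> a<l))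
      where a<l = FinP.<-trans a<k k<l

    pairChange-between : k Fin.< a → a Fin.< l → pairChange a
      ≡ (dInv x (f a) - dInv (f k) (f a)) + (dInv (f a) y - dInv (f a) (f l))
    pairChange-between k<a a<l = cong₂ _+_
      (cong₂ _-_ (pairInv-< k<a) (pairInv-< k<a)) (cong₂ _-_ (pairInv-> a<l) (pairInv-> a<l))

    pairChange-after : l Fin.< a → pairChange a
      ≡ (dInv x (f a) - dInv (f k) (f a)) + (dInv y (f a) - dInv (f l) (f a))
    pairChange-after l<a = cong₂ _+_
      (cong₂ _-_ (pairInv-< k<a) (pairInv-< k<a)) (cong₂ _-_ (pairInv-< l<a) (pairInv-< l<a))
      where k<a = FinP.<-trans k<l l<a

  twiceInv-update₂-≤ : (∀ a → a ≢ k → a ≢ l → pairChange a ≡ + 0) →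
                       dInv x y - dInv (f k) (f l) ℤ.≤ + 1 →
                       twiceInv (update₂ f k l x y) ℤ.≤ twiceInv f + + 2
  twiceInv-update₂-≤ change≡0 block≤1 = begin
    twiceInv (update₂ f k l x y)           ≡⟨ twiceInv-update₂ ⟩
    twiceInv f + + 2 * (sum (erase₂ k l pairChange) + D)
                                           ≡⟨ cong (λ s → twiceInv f + + 2 * (s + D))
                                                (sum-zero (erase₂-cases k≢l (_≡ + 0) refl change≡0)) ⟩
    twiceInv f + + 2 * (+ 0 + D)           ≡⟨ cong (λ s → twiceInv f + s) (double D) ⟩
    twiceInv f + (D + D)                   ≤⟨ ℤP.+-monoʳ-≤ (twiceInv f) (ℤP.+-mono-≤ block≤1 block≤1) ⟩
    twiceInv f + + 2                       ∎
    where
    open ℤP.≤-Reasoning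
    D = dInv x y - dInv (f k) (f l)
    double : ∀ d → + 2 * (+ 0 + d) ≡ d + d
    double = solve-∀

  twiceInv-update₂-≥ : (∀ a → a ≢ k → a ≢ l → + 0 ℤ.≤ pairChange a) →
                       dInv x y - dInv (f k) (f l) ≡ + 1 →
                       twiceInv f + + 2 ℤ.≤ twiceInv (update₂ f k l x y)
  twiceInv-update₂-≥ change≥0 block≡1 = begin
    twiceInv f + + 2                       ≤⟨ ℤP.+-monoʳ-≤ (twiceInv f) (ℤP.+-monoˡ-≤ (+ 2) (ℤP.+-mono-≤ S≥0 S≥0)) ⟩
    twiceInv f + ((S + S) + + 2)           ≡⟨ cong (λ s → twiceInv f + s) (double S) ⟩
    twiceInv f + + 2 * (S + + 1)           ≡⟨ cong (λ d → twiceInv f + + 2 * (S + d)) (sym block≡1) ⟩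
    twiceInv f + + 2 * (S + (dInv x y - dInv (f k) (f l)))
                                           ≡⟨ sym twiceInv-update₂ ⟩
    twiceInv (update₂ f k l x y)           ∎
    where
    open ℤP.≤-Reasoning
    S = sum (erase₂ k l pairChange)
    S≥0 : + 0 ℤ.≤ S
    S≥0 = subst (ℤ._≤ S) (sum-zero {n} (λ _ → refl))
                (sum-mono-≤ (erase₂-cases k≢l (+ 0 ℤ.≤_) ℤP.≤-refl change≥0))
    double : ∀ s → (s + s) + + 2 ≡ + 2 * (s + + 1)
    double = solve-∀

module _ {k l : Fin n} (P : Fin n → Set)
         (before : ∀ {a} → a Fin.< k → P a)
         (between : ∀ {a} → k Fin.< a → a Fin.< l → P a)
         (after : ∀ {a} → l Fin.< a → P a) where

  byPosition : ∀ a → a ≢ k → a ≢ l → P a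
  byPosition a a≢k a≢l with FinP.<-cmp a k | FinP.<-cmp a l
  ... | tri< a<k _ _ | _            = before a<k
  ... | tri≈ _ a≡k _ | _            = ⊥-elim (a≢k a≡k)
  ... | tri> _ _ k<a | tri< a<l _ _ = between k<a a<l
  ... | tri> _ _ _   | tri≈ _ a≡l _ = ⊥-elim (a≢l a≡l)
  ... | tri> _ _ _   | tri> _ _ l<a = after l<a

module Swap {k l : Fin n} (k<l : k Fin.< l) (f : Fin n → ℤ) where

  private module U = Update₂ k<l f (f l) (f k)
  open U public using (pairChange)

  change-before : ∀ {a} → a Fin.< k → pairChange a ≡ + 0
  change-before {a} a<k = trans (U.pairChange-before a<k) (cancel (dInv (f a) (f l)) (dInv (f a) (f k)))
    where
    cancel : ∀ p q → (p - q) + (q - p) ≡ + 0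
    cancel = solve-∀

  change-between : ∀ {a} → k Fin.< a → a Fin.< l → pairChange a ≡ signum (f l - f a) + signum (f a - f k)
  change-between {a} k<a a<l = begin
    pairChange a                                          ≡⟨ U.pairChange-between k<a a<l ⟩
    (dInv y z - dInv x z) + (dInv z x - dInv z y)         ≡⟨ cong₂ (λ p q → (p - dInv x z) + (q - dInv z y))
                                                               (dInv-antisym y z) (dInv-antisym z x) ⟩
    ((dInv z y + signum (y - z)) - dInv x z) + ((dInv x z + signum (z - x)) - dInv z y)
                                                          ≡⟨ cancel (dInv z y) (dInv x z) _ _ ⟩
    signum (y - z) + signum (z - x)                       ∎
    where
    open ≡-Reasoning
    x = f k
    y = f l
    z = f a
    cancel : ∀ p q s t → ((p + s) - q) + ((q + t) - p) ≡ s + t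
    cancel = solve-∀

  change-after : ∀ {a} → l Fin.< a → pairChange a ≡ + 0
  change-after {a} l<a = trans (U.pairChange-after l<a) (cancel (dInv (f l) (f a)) (dInv (f k) (f a)))
    where
    cancel : ∀ p q → (p - q) + (q - p) ≡ + 0
    cancel = solve-∀

  change-block : dInv (f l) (f k) - dInv (f k) (f l) ≡ signum (f l - f k)
  change-block = trans (cong (_- dInv (f k) (f l)) (dInv-antisym (f l) (f k))) (cancel (dInv (f k) (f l)) _)
    where
    cancel : ∀ p s → (p + s) - p ≡ s
    cancel = solve-∀

  twiceInv-≤ : (∀ {a} → k Fin.< a → a Fin.< l → ⊥) →
               twiceInv (update₂ f k l (f l) (f k)) ℤ.≤ twiceInv f + + 2
  twiceInv-≤ adjacent = U.twiceInv-update₂-≤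
    (byPosition (λ a → pairChange a ≡ + 0) change-before (λ k<a a<l → ⊥-elim (adjacent k<a a<l)) change-after)
    (subst (ℤ._≤ + 1) (sym change-block) (signum≤1 (f l - f k)))

  twiceInv-≥ : f k ℤ.< f l → twiceInv f + + 2 ℤ.≤ twiceInv (update₂ f k l (f l) (f k))
  twiceInv-≥ ascent = U.twiceInv-update₂-≥
    (byPosition (λ a → + 0 ℤ.≤ pairChange a)
      (λ a<k → ℤP.≤-reflexive (sym (change-before a<k)))
      (λ {a} k<a a<l → subst (+ 0 ℤ.≤_) (sym (change-between k<a a<l))
                         (signum-sum-nonneg (f l - f a) (f a - f k)
                           (subst (+ 0 ℤ.<_) (telescope (f l) (f a) (f k)) (m<n⇒0<n-m ascent))))
      (λ l<a → ℤP.≤-reflexive (sym (change-after l<a))))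
    (trans change-block (signum-pos (m<n⇒0<n-m ascent)))
    where
    telescope : ∀ y z x → y - x ≡ (y - z) + (z - x)
    telescope = solve-∀

module NegSwap {k l : Fin n} (k<l : k Fin.< l) (f : Fin n → ℤ) where

  private module U = Update₂ k<l f (- f l) (- f k)
  open U public using (pairChange)

  change-before : ∀ {a} → a Fin.< k → pairChange a
                ≡ (signum (f a + f l) + signum (f k - f a)) + (signum (f l - f a) + signum (f a + f k))
  change-before {a} a<k = begin
    pairChange a                                            ≡⟨ U.pairChange-before a<k ⟩
    (dInv z (- y) - dInv z x) + (dInv z (- x) - dInv z y)   ≡⟨ cong₂ (λ p q → (p - dInv z x) + (q - dInv z y))
                                                                 (dInv-negʳ z y) (dInv-negʳ z x) ⟩
    ((dInv y z + signum (z + y)) - dInv z x) + ((dInv x z + signum (z + x)) - dInv z y)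
                                                            ≡⟨ cong₂ (λ p q → ((p + signum (z + y)) - dInv z x)
                                                                              + ((q + signum (z + x)) - dInv z y))
                                                                 (dInv-antisym y z) (dInv-antisym x z) ⟩
    (((dInv z y + signum (y - z)) + signum (z + y)) - dInv z x)
      + (((dInv z x + signum (x - z)) + signum (z + x)) - dInv z y)
                                                            ≡⟨ cancel (dInv z y) (dInv z x) _ _ _ _ ⟩
    (signum (z + y) + signum (x - z)) + (signum (y - z) + signum (z + x))  ∎
    where
    open ≡-Reasoning
    x = f k
    y = f l
    z = f a
    cancel : ∀ p q s t u v → (((p + s) + t) - q) + (((q + u) + v) - p) ≡ (t + u) + (s + v)
    cancel = solve-∀

  change-between : ∀ {a} → k Fin.< a → a Fin.< l → pairChange a ≡ signum (f l - f a) + signum (f a + f k)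
  change-between {a} k<a a<l = begin
    pairChange a                                            ≡⟨ U.pairChange-between k<a a<l ⟩
    (dInv (- y) z - dInv x z) + (dInv z (- x) - dInv z y)   ≡⟨ cong₂ (λ p q → (p - dInv x z) + (q - dInv z y))
                                                                 (trans (dInv-negˡ y z) (dInv-antisym y z))
                                                                 (dInv-negʳ z x) ⟩
    ((dInv z y + signum (y - z)) - dInv x z) + ((dInv x z + signum (z + x)) - dInv z y)
                                                            ≡⟨ cancel (dInv z y) (dInv x z) _ _ ⟩
    signum (y - z) + signum (z + x)                         ∎
    where
    open ≡-Reasoning
    x = f k
    y = f l
    z = f a
    cancel : ∀ p q s t → ((p + s) - q) + ((q + t) - p) ≡ s + t
    cancel = solve-∀

  change-after : ∀ {a} → l Fin.< a → pairChange a ≡ + 0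
  change-after {a} l<a = begin
    pairChange a                                                    ≡⟨ U.pairChange-after l<a ⟩
    (dInv (- f l) (f a) - dInv (f k) (f a)) + (dInv (- f k) (f a) - dInv (f l) (f a))
                                                                    ≡⟨ cong₂ (λ p q → (p - dInv (f k) (f a))
                                                                                      + (q - dInv (f l) (f a)))
                                                                         (dInv-negˡ (f l) (f a)) (dInv-negˡ (f k) (f a)) ⟩
    (dInv (f l) (f a) - dInv (f k) (f a)) + (dInv (f k) (f a) - dInv (f l) (f a))
                                                                    ≡⟨ cancel (dInv (f l) (f a)) (dInv (f k) (f a)) ⟩
    + 0                                                             ∎
    where
    open ≡-Reasoning
    cancel : ∀ p q → (p - q) + (q - p) ≡ + 0
    cancel = solve-∀

  change-block : dInv (- f l) (- f k) - dInv (f k) (f l) ≡ signum (f l + f k)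
  change-block = trans (cong (_- dInv (f k) (f l)) (trans (dInv-negˡ (f l) (- f k)) (dInv-negʳ (f l) (f k))))
                       (cancel (dInv (f k) (f l)) _)
    where
    cancel : ∀ p s → (p + s) - p ≡ s
    cancel = solve-∀

  twiceInv-≤ : (∀ {a} → a Fin.< k → ⊥) → (∀ {a} → k Fin.< a → a Fin.< l → ⊥) →
               twiceInv (update₂ f k l (- f l) (- f k)) ℤ.≤ twiceInv f + + 2
  twiceInv-≤ first adjacent = U.twiceInv-update₂-≤
    (byPosition (λ a → pairChange a ≡ + 0)
      (λ a<k → ⊥-elim (first a<k)) (λ k<a a<l → ⊥-elim (adjacent k<a a<l)) change-after)
    (subst (ℤ._≤ + 1) (sym change-block) (signum≤1 (f l + f k)))

  twiceInv-≥ : + 0 ℤ.< f k + f l → twiceInv f + + 2 ℤ.≤ twiceInv (update₂ f k l (- f l) (- f k))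
  twiceInv-≥ ascent = U.twiceInv-update₂-≥
    (byPosition (λ a → + 0 ℤ.≤ pairChange a)
      (λ {a} a<k → subst (+ 0 ℤ.≤_) (sym (change-before a<k))
        (ℤP.+-mono-≤ (nonneg (f a + f l) (f k - f a) (split₁ (f k) (f l) (f a)))
                     (nonneg (f l - f a) (f a + f k) (split₂ (f k) (f l) (f a)))))
      (λ {a} k<a a<l → subst (+ 0 ℤ.≤_) (sym (change-between k<a a<l))
        (nonneg (f l - f a) (f a + f k) (split₂ (f k) (f l) (f a))))
      (λ l<a → ℤP.≤-reflexive (sym (change-after l<a))))
    (trans change-block (signum-pos (subst (+ 0 ℤ.<_) (ℤP.+-comm (f k) (f l)) ascent)))
    where
    nonneg : ∀ p q → f k + f l ≡ p + q → + 0 ℤ.≤ signum p + signum q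
    nonneg p q eq = signum-sum-nonneg p q (subst (+ 0 ℤ.<_) eq ascent)
    split₁ : ∀ x y z → x + y ≡ (z + y) + (x - z)
    split₁ = solve-∀
    split₂ : ∀ x y z → x + y ≡ (y - z) + (z + x)
    split₂ = solve-∀

module _ {k l : Fin n} (P : Fin n → Set)
         (before : ∀ {a} → a Fin.< k → P a) (at-k : P k)
         (between : ∀ {a} → k Fin.< a → a Fin.< l → P a) (at-l : P l)
         (after : ∀ {a} → l Fin.< a → P a) where

  everywhere : ∀ a → P a
  everywhere a with a ≟ k | a ≟ l
  ... | yes refl | _        = at-k
  ... | no _     | yes refl = at-l
  ... | no a≢k   | no a≢l   = byPosition P before between after a a≢k a≢l

below : ℕ → Fin n → ℤ
below m a = if ⌊ toℕ a ℕ.<? m ⌋ then + 1 else + 0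

module _ {m : ℕ} {a : Fin n} where

  below-yes : toℕ a ℕ.< m → below m a ≡ + 1
  below-yes a<m with toℕ a ℕ.<? m
  ... | yes _   = refl
  ... | no a≮m  = ⊥-elim (a≮m a<m)

  below-no : ¬ toℕ a ℕ.< m → below m a ≡ + 0
  below-no a≮m with toℕ a ℕ.<? m
  ... | yes a<m = ⊥-elim (a≮m a<m)
  ... | no _    = refl

sum-below : ∀ m → m ℕ.≤ n → sum (below {n} m) ≡ + m
sum-below {zero}  zero    _           = refl
sum-below {suc n} zero    _           = sum-zero {suc n} (λ _ → refl)
sum-below {suc n} (suc m) (ℕ.s≤s m≤n) =
  cong₂ _+_ (below-yes {m = suc m} {a = zero {n}} ℕ.z<s) (trans (sum-cong-≗ below-suc) (sum-below m m≤n))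
  where
  below-suc : (a : Fin n) → below (suc m) (suc a) ≡ below m a
  below-suc a with toℕ a ℕ.<? m
  ... | yes a<m = below-yes (ℕ.s≤s a<m)
  ... | no a≮m  = below-no (a≮m ∘ ℕ.s≤s⁻¹)

ι : Fin n → ℤ
ι a = + suc (toℕ a)

ι-mono : {a b : Fin n} → a Fin.< b → ι a ℤ.< ι b
ι-mono a<b = +<+ (ℕ.s≤s a<b)

ι+ι-pos : (a b : Fin n) → + 0 ℤ.< ι a + ι b
ι+ι-pos _ _ = +<+ (ℕ.s≤s ℕ.z≤n)

twiceInv-ι : twiceInv (ι {n}) ≡ + 0
twiceInv-ι {n} = sum-zero {n} (λ a → sum-zero {n} (no-inversion a))
  where
  no-inversion : ∀ a b → pairInv a b (ι a) (ι b) ≡ + 0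
  no-inversion a b = by-order (FinP.<-cmp a b)
    where
    by-order : Tri (a Fin.< b) (a ≡ b) (b Fin.< a) → pairInv a b (ι a) (ι b) ≡ + 0
    by-order (tri< a<b _ _)  = trans (pairInv-< a<b) (dInv-ascending (ι-mono a<b) (ι+ι-pos a b))
    by-order (tri≈ _ refl _) = pairInv-diag a
    by-order (tri> _ _ b<a)  = trans (pairInv-> b<a) (dInv-ascending (ι-mono b<a) (ι+ι-pos b a))

module FromIdentity {k l : Fin n} (k<l : k Fin.< l) where

  private
    K = toℕ k
    L = toℕ l

    a<k⇒a<l : ∀ {a : Fin n} → a Fin.< k → toℕ a ℕ.< L
    a<k⇒a<l a<k = ℕP.<-trans a<k k<l

    k<a⇒a≮1+k : ∀ {a : Fin n} → k Fin.< a → ¬ toℕ a ℕ.< suc K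
    k<a⇒a≮1+k k<a a<1+k = ℕP.<⇒≱ k<a (ℕ.s≤s⁻¹ a<1+k)

    l≤a⇒a≮l : ∀ {a : Fin n} → l Fin.≤ a → ¬ toℕ a ℕ.< L
    l≤a⇒a≮l = ℕP.≤⇒≯

    signum-ι : ∀ {a b : Fin n} → a Fin.< b → signum (ι b - ι a) ≡ + 1
    signum-ι a<b = signum-pos (m<n⇒0<n-m (ι-mono a<b))

    [_<l] [_≤k] [_<k] : Fin n → ℤ
    [_<l] = below L
    [_≤k] = below (suc K)
    [_<k] = below K

    sum-band : sum (λ a → [ a <l] - [ a ≤k]) ≡ + L - + suc K
    sum-band = trans (sum-sub [_<l] [_≤k])
                     (cong₂ _-_ (sum-below L (ℕP.<⇒≤ (FinP.toℕ<n l)))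
                                (sum-below (suc K) (ℕP.<-trans k<l (FinP.toℕ<n l))))

    k≢l : k ≢ l
    k≢l = FinP.<⇒≢ k<l

    a<k⇒a<1+k : ∀ {a : Fin n} → a Fin.< k → toℕ a ℕ.< suc K
    a<k⇒a<1+k = ℕP.m<n⇒m<1+n

    before-≢ : ∀ {a : Fin n} → a Fin.< k → a ≢ k × a ≢ l
    before-≢ a<k = FinP.<⇒≢ a<k , FinP.<⇒≢ (ℕP.<-trans a<k k<l)

    between-≢ : ∀ {a : Fin n} → k Fin.< a → a Fin.< l → a ≢ k × a ≢ l
    between-≢ k<a a<l = ≢-sym (FinP.<⇒≢ k<a) , FinP.<⇒≢ a<l

    after-≢ : ∀ {a : Fin n} → l Fin.< a → a ≢ k × a ≢ l
    after-≢ l<a = ≢-sym (FinP.<⇒≢ (ℕP.<-trans k<l l<a)) , ≢-sym (FinP.<⇒≢ l<a)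

    erase₂-at : (h : Fin n → ℤ) {a : Fin n} → a ≢ k × a ≢ l → ∀ {r} → h a ≡ r → erase₂ k l h a ≡ r
    erase₂-at h (a≢k , a≢l) = trans (erase₂-outside k≢l a≢k a≢l)

  twiceInv-swap : twiceInv (update₂ ι k l (ι l) (ι k)) ≡ + 2 * (+ 2 * (+ L - + suc K) + + 1)
  twiceInv-swap = begin
    twiceInv (update₂ ι k l (ι l) (ι k))                     ≡⟨ U.twiceInv-update₂ ⟩
    twiceInv (ι {n}) + + 2 * (sum (erase₂ k l pairChange) + (dInv (ι l) (ι k) - dInv (ι k) (ι l)))
                                                             ≡⟨ cong₂ (λ t s → t + + 2 * s) (twiceInv-ι {n})
                                                                  (cong₂ _+_ sum-erased (trans change-block (signum-ι k<l))) ⟩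
    + 0 + + 2 * (+ 2 * (+ L - + suc K) + + 1)                ≡⟨ ℤP.+-identityˡ _ ⟩
    + 2 * (+ 2 * (+ L - + suc K) + + 1)                      ∎
    where
    open ≡-Reasoning
    open Swap k<l ι
    module U = Update₂ k<l ι (ι l) (ι k)
    T : Fin n → ℤ
    T a = + 2 * ([ a <l] - [ a ≤k])
    T-at : ∀ {a p q} → [ a <l] ≡ p → [ a ≤k] ≡ q → T a ≡ + 2 * (p - q)
    T-at refl refl = refl
    erased : ∀ a → erase₂ k l pairChange a ≡ T a
    erased = everywhere (λ a → erase₂ k l pairChange a ≡ T a)
      (λ a<k → trans (erase₂-at pairChange (before-≢ a<k) (change-before a<k))
                     (sym (T-at (below-yes (a<k⇒a<l a<k)) (below-yes (a<k⇒a<1+k a<k)))))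
      (trans (erase₂-left k≢l) (sym (T-at (below-yes k<l) (below-yes (ℕP.n<1+n K)))))
      (λ k<a a<l → trans (erase₂-at pairChange (between-≢ k<a a<l)
                           (trans (change-between k<a a<l) (cong₂ _+_ (signum-ι a<l) (signum-ι k<a))))
                         (sym (T-at (below-yes a<l) (below-no (k<a⇒a≮1+k k<a)))))
      (trans (erase₂-right k≢l) (sym (T-at (below-no (ℕP.<-irrefl refl)) (below-no (k<a⇒a≮1+k k<l)))))
      (λ l<a → trans (erase₂-at pairChange (after-≢ l<a) (change-after l<a))
                     (sym (T-at (below-no (l≤a⇒a≮l (ℕP.<⇒≤ l<a)))
                                (below-no (k<a⇒a≮1+k (ℕP.<-trans k<l l<a))))))
    sum-erased : sum (erase₂ k l pairChange) ≡ + 2 * (+ L - + suc K)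
    sum-erased = begin
      sum (erase₂ k l pairChange)                          ≡⟨ sum-cong-≗ erased ⟩
      sum T                                                ≡⟨ sym (*-distribˡ-sum (+ 2) (λ a → [ a <l] - [ a ≤k])) ⟩
      + 2 * sum (λ a → [ a <l] - [ a ≤k])                  ≡⟨ cong (+ 2 *_) sum-band ⟩
      + 2 * (+ L - + suc K)                                ∎

  twiceInv-negSwap : twiceInv (update₂ ι k l (- ι l) (- ι k))
                   ≡ + 2 * (+ 2 * ((+ L - + suc K) + + 2 * + K) + + 1)
  twiceInv-negSwap = begin
    twiceInv (update₂ ι k l (- ι l) (- ι k))                 ≡⟨ U.twiceInv-update₂ ⟩
    twiceInv (ι {n}) + + 2 * (sum (erase₂ k l pairChange) + (dInv (- ι l) (- ι k) - dInv (ι k) (ι l)))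
                                                             ≡⟨ cong₂ (λ t s → t + + 2 * s) (twiceInv-ι {n})
                                                                  (cong₂ _+_ sum-erased
                                                                    (trans change-block (signum-pos (ι+ι-pos l k)))) ⟩
    + 0 + + 2 * (+ 2 * ((+ L - + suc K) + + 2 * + K) + + 1)  ≡⟨ ℤP.+-identityˡ _ ⟩
    + 2 * (+ 2 * ((+ L - + suc K) + + 2 * + K) + + 1)        ∎
    where
    open ≡-Reasoning
    open NegSwap k<l ι
    module U = Update₂ k<l ι (- ι l) (- ι k)
    T : Fin n → ℤ
    T a = + 2 * (([ a <l] - [ a ≤k]) + + 2 * [ a <k])
    T-at : ∀ {a p q r} → [ a <l] ≡ p → [ a ≤k] ≡ q → [ a <k] ≡ r → T a ≡ + 2 * ((p - q) + + 2 * r)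
    T-at refl refl refl = refl
    k<a⇒a≮k : ∀ {a : Fin n} → k Fin.< a → ¬ toℕ a ℕ.< K
    k<a⇒a≮k = ℕP.<⇒≯
    erased : ∀ a → erase₂ k l pairChange a ≡ T a
    erased = everywhere (λ a → erase₂ k l pairChange a ≡ T a)
      (λ {a} a<k → trans (erase₂-at pairChange (before-≢ a<k)
                       (trans (change-before a<k)
                         (cong₂ _+_ (cong₂ _+_ (signum-pos (ι+ι-pos a l)) (signum-ι a<k))
                                    (cong₂ _+_ (signum-ι (ℕP.<-trans a<k k<l)) (signum-pos (ι+ι-pos a k))))))
                     (sym (T-at (below-yes (a<k⇒a<l a<k)) (below-yes (a<k⇒a<1+k a<k)) (below-yes a<k))))
      (trans (erase₂-left k≢l)
             (sym (T-at (below-yes k<l) (below-yes (ℕP.n<1+n K)) (below-no (ℕP.<-irrefl refl)))))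
      (λ {a} k<a a<l → trans (erase₂-at pairChange (between-≢ k<a a<l)
                           (trans (change-between k<a a<l) (cong₂ _+_ (signum-ι a<l) (signum-pos (ι+ι-pos a k)))))
                         (sym (T-at (below-yes a<l) (below-no (k<a⇒a≮1+k k<a)) (below-no (k<a⇒a≮k k<a)))))
      (trans (erase₂-right k≢l)
             (sym (T-at (below-no (ℕP.<-irrefl refl)) (below-no (k<a⇒a≮1+k k<l)) (below-no (k<a⇒a≮k k<l)))))
      (λ l<a → trans (erase₂-at pairChange (after-≢ l<a) (change-after l<a))
                     (sym (T-at (below-no (l≤a⇒a≮l (ℕP.<⇒≤ l<a)))
                                (below-no (k<a⇒a≮1+k (ℕP.<-trans k<l l<a)))
                                (below-no (k<a⇒a≮k (ℕP.<-trans k<l l<a))))))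
    sum-erased : sum (erase₂ k l pairChange) ≡ + 2 * ((+ L - + suc K) + + 2 * + K)
    sum-erased = begin
      sum (erase₂ k l pairChange)                          ≡⟨ sum-cong-≗ erased ⟩
      sum T                                                ≡⟨ sym (*-distribˡ-sum (+ 2) band+2below) ⟩
      + 2 * sum band+2below                                ≡⟨ cong (+ 2 *_) (∑-distrib-+ band (λ a → + 2 * [ a <k])) ⟩
      + 2 * (sum band + sum (λ a → + 2 * [ a <k]))         ≡⟨ cong (λ s → + 2 * (sum band + s))
                                                                (sym (*-distribˡ-sum (+ 2) [_<k])) ⟩
      + 2 * (sum band + + 2 * sum [_<k])                   ≡⟨ cong₂ (λ p q → + 2 * (p + + 2 * q))
                                                                sum-band (sum-below K (ℕP.<⇒≤ (FinP.toℕ<n k))) ⟩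
      + 2 * ((+ L - + suc K) + + 2 * + K)                  ∎
      where
      band band+2below : Fin n → ℤ
      band a = [ a <l] - [ a ≤k]
      band+2below a = band a + + 2 * [ a <k]

signed : SVal n → ℤ
signed (false , k) = ι k
signed (true  , k) = - ι k

-- Entries are ±(|w(a)| + 1): the absolute values of Defs are 0-indexed.
⟦_⟧ : SPerm n → Fin n → ℤ
⟦ w ⟧ a = signed (lookup w a)

≡-by-lookup : ∀ {A : Set} {u v : Vec A n} → (∀ a → lookup u a ≡ lookup v a) → u ≡ v
≡-by-lookup {u = u} {v} u≗v =
  trans (sym (tabulate∘lookup u)) (trans (tabulate-cong u≗v) (tabulate∘lookup v))

lookup-· : (u v : SPerm n) (a : Fin n) → lookup (u · v) a ≡ apply u (lookup v a)
lookup-· u v a = lookup∘tabulate _ a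

apply-· : (u v : SPerm n) (x : SVal n) → apply (u · v) x ≡ apply u (apply v x)
apply-· u v (b , j) rewrite lookup-· u v j with lookup v j
... | c , k with lookup u k
...   | d , m = cong (_, m) (sym (xor-assoc b c d))

apply-false : (w : SPerm n) (j : Fin n) → apply w (false , j) ≡ lookup w j
apply-false w j with lookup w j
... | c , k = refl

negateIf : Bool → ℤ → ℤ
negateIf false x = x
negateIf true  x = - x

signed-apply : (w : SPerm n) (c : Bool) (j : Fin n) → signed (apply w (c , j)) ≡ negateIf c (⟦ w ⟧ j)
signed-apply w c j with lookup w j
signed-apply w false j | _ , _     = refl
signed-apply w true  j | false , _ = refl
signed-apply w true  j | true  , k = sym (ℤP.neg-involutive (ι k))

·-assoc : (u v w : SPerm n) → (u · v) · w ≡ u · (v · w)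
·-assoc u v w = ≡-by-lookup λ a → begin
  lookup ((u · v) · w) a          ≡⟨ lookup-· (u · v) w a ⟩
  apply (u · v) (lookup w a)      ≡⟨ apply-· u v (lookup w a) ⟩
  apply u (apply v (lookup w a))  ≡⟨ cong (apply u) (sym (lookup-· v w a)) ⟩
  apply u (lookup (v · w) a)      ≡⟨ sym (lookup-· u (v · w) a) ⟩
  lookup (u · (v · w)) a          ∎
  where open ≡-Reasoning

lookup-idP : (a : Fin n) → lookup idP a ≡ (false , a)
lookup-idP a = lookup∘tabulate _ a

·-identityʳ : (w : SPerm n) → w · idP ≡ w
·-identityʳ w = ≡-by-lookup λ a →
  trans (lookup-· w idP a) (trans (cong (apply w) (lookup-idP a)) (apply-false w a))

·-identityˡ : (w : SPerm n) → idP · w ≡ w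
·-identityˡ w = ≡-by-lookup λ a → trans (lookup-· idP w a) (apply-idP (lookup w a))
  where
  apply-idP : ∀ x → apply idP x ≡ x
  apply-idP (b , j) rewrite lookup-idP j = cong (_, j) (xor-identityʳ b)

⟦idP⟧ : (a : Fin n) → ⟦ idP ⟧ a ≡ ι a
⟦idP⟧ a = cong signed (lookup-idP a)

-- sPerm i j and tPerm i j are, by definition, transposition false i j and transposition true i j.
transposition : Bool → Fin n → Fin n → SPerm n
transposition c i j = tabulate λ k →
  if ⌊ k ≟ i ⌋ then (c , j) else if ⌊ k ≟ j ⌋ then (c , i) else (false , k)

transpose : Fin n → Fin n → Fin n → Fin n
transpose i j a = if ⌊ a ≟ i ⌋ then j else if ⌊ a ≟ j ⌋ then i else a

if-≟-refl : ∀ {A : Set} (a : Fin n) {x y : A} → (if ⌊ a ≟ a ⌋ then x else y) ≡ x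
if-≟-refl a = cong (if_then _ else _) (trans (isYes≗does (a ≟ a)) (dec-true (a ≟ a) refl))

if-≟-no : ∀ {A : Set} {a b : Fin n} {x y : A} → a ≢ b → (if ⌊ a ≟ b ⌋ then x else y) ≡ y
if-≟-no {a = a} {b} a≢b = cong (if_then _ else _) (trans (isYes≗does (a ≟ b)) (dec-false (a ≟ b) a≢b))

module _ {i j : Fin n} (i≢j : i ≢ j) where

  at-i-j-or-else : (P : Fin n → Set) → P i → P j → (∀ {a} → a ≢ i → a ≢ j → P a) → ∀ a → P a
  at-i-j-or-else P Pi Pj Pa a with a ≟ i | a ≟ j
  ... | yes refl | _        = Pi
  ... | no _     | yes refl = Pj
  ... | no a≢i   | no a≢j   = Pa a≢i a≢j

  module _ {c : Bool} where

    lookup-transposition-i : lookup (transposition c i j) i ≡ (c , j)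
    lookup-transposition-i = trans (lookup∘tabulate _ i) (if-≟-refl i)

    lookup-transposition-j : lookup (transposition c i j) j ≡ (c , i)
    lookup-transposition-j = trans (lookup∘tabulate _ j) (trans (if-≟-no (≢-sym i≢j)) (if-≟-refl j))

    lookup-transposition-other : ∀ {a} → a ≢ i → a ≢ j → lookup (transposition c i j) a ≡ (false , a)
    lookup-transposition-other {a} a≢i a≢j =
      trans (lookup∘tabulate _ a) (trans (if-≟-no a≢i) (if-≟-no a≢j))

  transpose-i : transpose i j i ≡ j
  transpose-i = if-≟-refl i

  transpose-j : transpose i j j ≡ i
  transpose-j = trans (if-≟-no (≢-sym i≢j)) (if-≟-refl j)

  transpose-other : ∀ {a} → a ≢ i → a ≢ j → transpose i j a ≡ a
  transpose-other a≢i a≢j = trans (if-≟-no a≢i) (if-≟-no a≢j)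

  transpose-involutive : ∀ a → transpose i j (transpose i j a) ≡ a
  transpose-involutive = at-i-j-or-else (λ a → transpose i j (transpose i j a) ≡ a)
    (trans (cong (transpose i j) transpose-i) transpose-j)
    (trans (cong (transpose i j) transpose-j) transpose-i)
    (λ a≢i a≢j → trans (cong (transpose i j) (transpose-other a≢i a≢j)) (transpose-other a≢i a≢j))

  lookup-sPerm : ∀ a → lookup (sPerm i j) a ≡ (false , transpose i j a)
  lookup-sPerm = at-i-j-or-else (λ a → lookup (sPerm i j) a ≡ (false , transpose i j a))
    (trans lookup-transposition-i (cong (false ,_) (sym transpose-i)))
    (trans lookup-transposition-j (cong (false ,_) (sym transpose-j)))
    (λ a≢i a≢j → trans (lookup-transposition-other a≢i a≢j) (cong (false ,_) (sym (transpose-other a≢i a≢j))))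

  apply-sPerm : ∀ c y → apply (sPerm i j) (c , y) ≡ (c , transpose i j y)
  apply-sPerm c y rewrite lookup-sPerm y = cong (_, transpose i j y) (xor-identityʳ c)

module _ {p q : Fin n} (p≢q : p ≢ q) where

  private
    τ = transpose p q
    S = sPerm p q

    relabel : SVal n → SVal n
    relabel x = (proj₁ x , τ (proj₂ x))

  lookup-conjugate : (X : SPerm n) (a : Fin n) → lookup (S · (X · S)) a ≡ relabel (lookup X (τ a))
  lookup-conjugate X a = begin
    lookup (S · (X · S)) a           ≡⟨ lookup-· S (X · S) a ⟩
    apply S (lookup (X · S) a)       ≡⟨ cong (apply S) (lookup-· X S a) ⟩
    apply S (apply X (lookup S a))   ≡⟨ cong (apply S ∘ apply X) (lookup-sPerm p≢q a) ⟩
    apply S (apply X (false , τ a))  ≡⟨ cong (apply S) (apply-false X (τ a)) ⟩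
    apply S (lookup X (τ a))         ≡⟨ apply-sPerm p≢q _ _ ⟩
    relabel (lookup X (τ a))         ∎
    where open ≡-Reasoning

  conjugate : ∀ {c i j} → i ≢ j → S · (transposition c i j · S) ≡ transposition c (τ i) (τ j)
  conjugate {c} {i} {j} i≢j = ≡-by-lookup (at-i-j-or-else τi≢τj (λ a → lookup (S · (X · S)) a ≡ lookup X′ a)
    (through (τ-τ i) (lookup-transposition-i i≢j) (lookup-transposition-i τi≢τj))
    (through (τ-τ j) (lookup-transposition-j i≢j) (lookup-transposition-j τi≢τj))
    (λ {a} a≢τi a≢τj →
      through refl (lookup-transposition-other i≢j (a≢τi ∘ τ-swap) (a≢τj ∘ τ-swap))
        (trans (lookup-transposition-other τi≢τj a≢τi a≢τj) (cong (false ,_) (sym (τ-τ a))))))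
    where
    X X′ : SPerm n
    X = transposition c i j
    X′ = transposition c (τ i) (τ j)
    τ-τ : ∀ a → τ (τ a) ≡ a
    τ-τ = transpose-involutive p≢q
    τ-swap : ∀ {a b} → τ a ≡ b → a ≡ τ b
    τ-swap {a} τa≡b = trans (sym (τ-τ a)) (cong τ τa≡b)
    τi≢τj : τ i ≢ τ j
    τi≢τj τi≡τj = i≢j (trans (sym (τ-τ i)) (trans (cong τ τi≡τj) (τ-τ j)))
    through : ∀ {a b y c′} → τ a ≡ b → lookup X b ≡ (c′ , y) → lookup X′ a ≡ (c′ , τ y) →
              lookup (S · (X · S)) a ≡ lookup X′ a
    through τa≡b X-b X′-a = trans (lookup-conjugate X _) (trans (cong relabel (trans (cong (lookup X) τa≡b) X-b)) (sym X′-a))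

twiceInv-cong : (∀ a → f a ≡ g a) → twiceInv f ≡ twiceInv g
twiceInv-cong f≗g = sum-cong-≗ λ a → sum-cong-≗ λ b → cong₂ (pairInv a b) (f≗g a) (f≗g b)

⟦·transposition⟧ : {k l : Fin n} → k ≢ l → (w : SPerm n) (c : Bool) →
  ∀ a → ⟦ w · transposition c k l ⟧ a ≡ update₂ ⟦ w ⟧ k l (negateIf c (⟦ w ⟧ l)) (negateIf c (⟦ w ⟧ k)) a
⟦·transposition⟧ {n} {k} {l} k≢l w c = at-i-j-or-else k≢l P
  (trans (at (lookup-transposition-i k≢l)) (sym (update₂-left k≢l)))
  (trans (at (lookup-transposition-j k≢l)) (sym (update₂-right k≢l)))
  (λ a≢k a≢l → trans (at (lookup-transposition-other k≢l a≢k a≢l)) (sym (update₂-outside k≢l a≢k a≢l)))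
  where
  P : Fin n → Set
  P a = ⟦ w · transposition c k l ⟧ a ≡ update₂ ⟦ w ⟧ k l (negateIf c (⟦ w ⟧ l)) (negateIf c (⟦ w ⟧ k)) a
  at : ∀ {a c′ b} → lookup (transposition c k l) a ≡ (c′ , b) → ⟦ w · transposition c k l ⟧ a ≡ negateIf c′ (⟦ w ⟧ b)
  at {a} {c′} {b} X-a =
    trans (cong signed (trans (lookup-· w (transposition c k l) a) (cong (apply w) X-a))) (signed-apply w c′ b)

⟦transposition⟧ : {k l : Fin n} → k ≢ l → (c : Bool) →
  ∀ a → ⟦ transposition c k l ⟧ a ≡ update₂ ι k l (negateIf c (ι l)) (negateIf c (ι k)) a
⟦transposition⟧ {n} {k} {l} k≢l c = at-i-j-or-else k≢l P
  (trans (cong signed (lookup-transposition-i k≢l)) (trans (signed-negateIf c l) (sym (update₂-left k≢l))))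
  (trans (cong signed (lookup-transposition-j k≢l)) (trans (signed-negateIf c k) (sym (update₂-right k≢l))))
  (λ a≢k a≢l → trans (cong signed (lookup-transposition-other k≢l a≢k a≢l)) (sym (update₂-outside k≢l a≢k a≢l)))
  where
  P : Fin n → Set
  P a = ⟦ transposition c k l ⟧ a ≡ update₂ ι k l (negateIf c (ι l)) (negateIf c (ι k)) a
  signed-negateIf : ∀ c b → signed (c , b) ≡ negateIf c (ι b)
  signed-negateIf false b = refl
  signed-negateIf true  b = refl

-- Roots, words and lengths in D_n

module _ {m : ℕ} where

  private
    F = Fin (suc (suc m))
    V = F → ℤ

  nonneg-cong : {v w : V} → (∀ x → v x ≡ w x) → NonnegSimple v → NonnegSimple w
  nonneg-cong v≗w (c , c·α≗v) = c , λ x → trans (c·α≗v x) (v≗w x)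

  nonneg-0 : NonnegSimple {m} (λ _ → + 0)
  nonneg-0 = (λ _ → 0) , λ x →
    trans (sumFin≡sum (λ k → + 0 * simpleRoot k x)) (sum-zero (λ k → ℤP.*-zeroˡ (simpleRoot k x)))

  nonneg-+ : {v w : V} → NonnegSimple v → NonnegSimple w → NonnegSimple (λ x → v x + w x)
  nonneg-+ {v} {w} (c , c·α≗v) (c′ , c′·α≗w) = (λ k → c k ℕ.+ c′ k) , λ x → begin
    sumFin (λ k → + (c k ℕ.+ c′ k) * simpleRoot k x)                   ≡⟨ sumFin≡sum (λ k → + (c k ℕ.+ c′ k) * simpleRoot k x) ⟩
    sum (λ k → + (c k ℕ.+ c′ k) * simpleRoot k x)                      ≡⟨ sum-cong-≗ (λ k →
                                                                            ℤP.*-distribʳ-+ (simpleRoot k x) (+ c k) (+ c′ k)) ⟩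
    sum (λ k → + c k * simpleRoot k x + + c′ k * simpleRoot k x)       ≡⟨ ∑-distrib-+ (cα x) (c′α x) ⟩
    sum (cα x) + sum (c′α x)
                                                                       ≡⟨ sym (cong₂ _+_ (sumFin≡sum (cα x)) (sumFin≡sum (c′α x))) ⟩
    sumFin (cα x) + sumFin (c′α x)
                                                                       ≡⟨ cong₂ _+_ (c·α≗v x) (c′·α≗w x) ⟩
    v x + w x                                                          ∎
    where
    open ≡-Reasoning
    cα c′α : F → F → ℤ
    cα x k = + c k * simpleRoot k x
    c′α x k = + c′ k * simpleRoot k x

  nonneg-simpleRoot : (g : F) → NonnegSimple (simpleRoot g)
  nonneg-simpleRoot g = δ , λ x → begin
    sumFin (δα x)                                  ≡⟨ sumFin≡sum (δα x) ⟩
    sum (δα x)                                     ≡⟨ sum-erase (δα x) g ⟩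
    sum (updateAt (δα x) g (const (+ 0))) + δα x g ≡⟨ cong₂ _+_ (sum-zero (off x)) (at x) ⟩
    + 0 + simpleRoot g x                           ≡⟨ ℤP.+-identityˡ _ ⟩
    simpleRoot g x                                 ∎
    where
    open ≡-Reasoning
    δ : F → ℕ
    δ k = if ⌊ k ≟ g ⌋ then 1 else 0
    δα : F → F → ℤ
    δα x k = + δ k * simpleRoot k x
    at : ∀ x → δα x g ≡ simpleRoot g x
    at x = trans (cong (λ c → + c * simpleRoot g x) (if-≟-refl g)) (ℤP.*-identityˡ _)
    off : ∀ x a → updateAt (δα x) g (const (+ 0)) a ≡ + 0
    off x a with a ≟ g
    ... | yes refl = updateAt-updates a (δα x)
    ... | no a≢g   = trans (updateAt-minimal a g (δα x) a≢g)
                           (trans (cong (λ c → + c * simpleRoot a x) (if-≟-no a≢g)) (ℤP.*-zeroˡ (simpleRoot a x)))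

  nonneg-e-e : ∀ d {a b : F} → toℕ b ≡ toℕ a ℕ.+ d → NonnegSimple (λ x → e a x - e b x)
  nonneg-e-e zero {a} {b} b≡a+0 with FinP.toℕ-injective (trans b≡a+0 (ℕP.+-identityʳ (toℕ a)))
  ... | refl = nonneg-cong (λ x → sym (ℤP.+-inverseʳ (e a x))) nonneg-0
  nonneg-e-e (suc d) {a} {zero}  0≡a+1+d = ⊥-elim (ℕP.0≢1+n (trans 0≡a+1+d (ℕP.+-suc (toℕ a) d)))
  nonneg-e-e (suc d) {a} {suc k} b≡a+1+d =
    nonneg-cong telescope (nonneg-+ (nonneg-e-e d k≡a+d) (nonneg-simpleRoot (suc k)))
    where
    k≡a+d : toℕ (inject₁ k) ≡ toℕ a ℕ.+ d
    k≡a+d = trans (FinP.toℕ-inject₁ k) (ℕP.suc-injective (trans b≡a+1+d (ℕP.+-suc (toℕ a) d)))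
    telescope : ∀ x → (e a x - e (inject₁ k) x) + (e (inject₁ k) x - e (suc k) x) ≡ e a x - e (suc k) x
    telescope x = cancel (e a x) (e (inject₁ k) x) (e (suc k) x)
      where
      cancel : ∀ p q r → (p - q) + (q - r) ≡ p - r
      cancel = solve-∀

  nonneg-e-e≤ : {a b : F} → toℕ a ℕ.≤ toℕ b → NonnegSimple (λ x → e a x - e b x)
  nonneg-e-e≤ a≤b = nonneg-e-e _ (sym (ℕP.m+[n∸m]≡n a≤b))

  nonneg-sRoot : {a b : F} → a Fin.< b → NonnegSimple (λ x → e a x - e b x)
  nonneg-sRoot a<b = nonneg-e-e≤ (ℕP.<⇒≤ a<b)

  -- −e_a − e_b = (−e_1 − e_2) + (e_1 − e_a) + (e_2 − e_b)
  nonneg-tRoot : {a b : F} → a Fin.< b → NonnegSimple (λ x → - e a x - e b x)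
  nonneg-tRoot {a} {b} a<b =
    nonneg-cong regroup (nonneg-+ (nonneg-+ (nonneg-simpleRoot zero) (nonneg-e-e≤ {zero} {a} ℕ.z≤n))
                                 (nonneg-e-e≤ {suc zero} {b} (ℕP.≤-trans (ℕ.s≤s ℕ.z≤n) a<b)))
    where
    regroup : ∀ x → ((- e zero x - e (suc zero) x) + (e zero x - e a x)) + (e (suc zero) x - e b x)
                  ≡ - e a x - e b x
    regroup x = cancel (e zero x) (e (suc zero) x) (e a x) (e b x)
      where
      cancel : ∀ p q r s → ((- p - q) + (p - r)) + (q - s) ≡ - r - s
      cancel = solve-∀

  evalWord-∷ʳ : (ws : List F) (g : F) → evalWord (ws ++ [ g ]) ≡ evalWord ws · simpleGen g
  evalWord-∷ʳ []       g = trans (·-identityʳ (simpleGen g)) (sym (·-identityˡ (simpleGen g)))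
  evalWord-∷ʳ (h ∷ ws) g = trans (cong (simpleGen h ·_) (evalWord-∷ʳ ws g))
                                 (sym (·-assoc (simpleGen h) (evalWord ws) (simpleGen g)))

  length-conjugate : (ws : List F) (g : F) → length (g ∷ ws ++ [ g ]) ≡ suc (suc (length ws))
  length-conjugate ws g = cong suc (trans (ListP.length-++ ws) (ℕP.+-comm (length ws) 1))

  inject₁≢suc : (k : Fin (suc m)) → inject₁ k ≢ suc k
  inject₁≢suc k eq = ℕP.1+n≢n (sym (trans (sym (FinP.toℕ-inject₁ k)) (cong toℕ eq)))

  conjugate-word : ∀ (k : Fin (suc m)) {c} {i j : F} {ws} → i ≢ j → IsWord (transposition c i j) ws →
    IsWord (transposition c (transpose (inject₁ k) (suc k) i) (transpose (inject₁ k) (suc k) j)) (suc k ∷ ws ++ [ suc k ])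
  conjugate-word k {ws = ws} i≢j isWord =
    trans (cong (simpleGen (suc k) ·_) (trans (evalWord-∷ʳ ws (suc k)) (cong (_· simpleGen (suc k)) isWord)))
          (conjugate (inject₁≢suc k) i≢j)

  inject₁<suc : (k : Fin (suc m)) → inject₁ k Fin.< suc k
  inject₁<suc k = ℕ.s≤s (ℕP.≤-reflexive (FinP.toℕ-inject₁ k))

  private
    length-step : ∀ d → ℕ.suc (ℕ.suc (ℕ.suc (d ℕ.+ d))) ≡ ℕ.suc (ℕ.suc d ℕ.+ ℕ.suc d)
    length-step d = cong (λ (x : ℕ) → suc (suc x)) (sym (ℕP.+-suc d d))

  word-sPerm : ∀ d {i j : F} → toℕ j ≡ toℕ i ℕ.+ suc d →
               Σ[ ws ∈ List F ] (IsWord (sPerm i j) ws × length ws ≡ suc (d ℕ.+ d))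
  word-sPerm d {i} {zero} 0≡i+1+d = ⊥-elim (ℕP.0≢1+n (trans 0≡i+1+d (ℕP.+-suc (toℕ i) d)))
  word-sPerm zero {i} {suc k} eq = [ suc k ] , trans (·-identityʳ _) (cong (λ a → sPerm a (suc k)) k≡i) , refl
    where
    k≡i : inject₁ k ≡ i
    k≡i = FinP.toℕ-injective (trans (FinP.toℕ-inject₁ k) (ℕP.suc-injective (trans eq (ℕP.+-comm (toℕ i) 1))))
  word-sPerm (suc d) {i} {suc k} eq = conjugated (word-sPerm d k≡i+1+d)
    where
    k≡i+1+d : toℕ (inject₁ k) ≡ toℕ i ℕ.+ suc d
    k≡i+1+d = trans (FinP.toℕ-inject₁ k) (ℕP.suc-injective (trans eq (ℕP.+-suc (toℕ i) (suc d))))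
    i<k : i Fin.< inject₁ k
    i<k = subst (toℕ i ℕ.<_) (sym k≡i+1+d) (ℕP.m<m+n (toℕ i) ℕ.z<s)
    i≢k : i ≢ inject₁ k
    i≢k = FinP.<⇒≢ i<k
    i≢suc-k : i ≢ suc k
    i≢suc-k = FinP.<⇒≢ (ℕP.<-trans i<k (inject₁<suc k))
    conjugated : Σ[ ws ∈ List F ] (IsWord (sPerm i (inject₁ k)) ws × length ws ≡ suc (d ℕ.+ d)) →
                 Σ[ ws ∈ List F ] (IsWord (sPerm i (suc k)) ws × length ws ≡ suc (suc d ℕ.+ suc d))
    conjugated (ws , isWord , len) =
      suc k ∷ ws ++ [ suc k ] ,
      trans (conjugate-word k {ws = ws} i≢k isWord) (cong₂ sPerm (transpose-other (inject₁≢suc k) i≢k i≢suc-k)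
                                                         (transpose-i (inject₁≢suc k))) ,
      trans (length-conjugate ws (suc k)) (trans (cong (λ (x : ℕ) → suc (suc x)) len) (length-step d))

  word-tPerm₀ : ∀ d {j : F} → toℕ j ≡ suc d →
                Σ[ ws ∈ List F ] (IsWord (tPerm zero j) ws × length ws ≡ suc (d ℕ.+ d))
  word-tPerm₀ d       {zero}  ()
  word-tPerm₀ zero    {suc k} eq with FinP.toℕ-injective {i = k} {zero} (ℕP.suc-injective eq)
  ... | refl = [ zero ] , ·-identityʳ _ , refl
  word-tPerm₀ (suc d) {suc k} eq = conjugated (word-tPerm₀ d k≡1+d)
    where
    k≡1+d : toℕ (inject₁ k) ≡ suc d
    k≡1+d = trans (FinP.toℕ-inject₁ k) (ℕP.suc-injective eq)
    0≢k : zero ≢ inject₁ k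
    0≢k 0≡k = ℕP.0≢1+n (trans (cong toℕ 0≡k) k≡1+d)
    conjugated : Σ[ ws ∈ List F ] (IsWord (tPerm zero (inject₁ k)) ws × length ws ≡ suc (d ℕ.+ d)) →
                 Σ[ ws ∈ List F ] (IsWord (tPerm zero (suc k)) ws × length ws ≡ suc (suc d ℕ.+ suc d))
    conjugated (ws , isWord , len) =
      suc k ∷ ws ++ [ suc k ] ,
      trans (conjugate-word k {ws = ws} 0≢k isWord)
            (cong₂ tPerm (transpose-other (inject₁≢suc k) 0≢k (λ ())) (transpose-i (inject₁≢suc k))) ,
      trans (length-conjugate ws (suc k)) (trans (cong (λ (x : ℕ) → suc (suc x)) len) (length-step d))

  word-tPerm : ∀ c {i j : F} → toℕ i ≡ c → i Fin.< j →
               Σ[ ws ∈ List F ] (IsWord (tPerm i j) ws × suc (length ws) ≡ (toℕ i ℕ.+ toℕ i) ℕ.+ (toℕ j ℕ.+ toℕ j))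
  word-tPerm c       {zero}  {suc k} _ _ with word-tPerm₀ (toℕ k) {suc k} refl
  ... | ws , isWord , len = ws , isWord , cong suc (trans len (sym (ℕP.+-suc (toℕ k) (toℕ k))))
  word-tPerm (suc c) {suc k} {j} i≡1+c k<j = conjugated (word-tPerm c k≡c (ℕP.<-trans (inject₁<suc k) k<j))
    where
    k≡c : toℕ (inject₁ k) ≡ c
    k≡c = trans (FinP.toℕ-inject₁ k) (ℕP.suc-injective i≡1+c)
    j≢k : j ≢ inject₁ k
    j≢k = ≢-sym (FinP.<⇒≢ (ℕP.<-trans (inject₁<suc k) k<j))
    j≢suc-k : j ≢ suc k
    j≢suc-k = ≢-sym (FinP.<⇒≢ k<j)
    conjugated : Σ[ ws ∈ List F ] (IsWord (tPerm (inject₁ k) j) ws ×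
                   suc (length ws) ≡ (toℕ (inject₁ k) ℕ.+ toℕ (inject₁ k)) ℕ.+ (toℕ j ℕ.+ toℕ j)) →
                 Σ[ ws ∈ List F ] (IsWord (tPerm (suc k) j) ws ×
                   suc (length ws) ≡ (toℕ (suc k) ℕ.+ toℕ (suc k)) ℕ.+ (toℕ j ℕ.+ toℕ j))
    conjugated (ws , isWord , len) =
      suc k ∷ ws ++ [ suc k ] ,
      trans (conjugate-word k {ws = ws} (FinP.<⇒≢ (ℕP.<-trans (inject₁<suc k) k<j)) isWord)
            (cong₂ tPerm (transpose-i (inject₁≢suc k)) (transpose-other (inject₁≢suc k) j≢k j≢suc-k)) ,
      (begin
        suc (length (suc k ∷ ws ++ [ suc k ]))         ≡⟨ cong suc (length-conjugate ws (suc k)) ⟩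
        suc (suc (suc (length ws)))                    ≡⟨ cong (λ (x : ℕ) → suc (suc x)) len ⟩
        suc (suc ((K ℕ.+ K) ℕ.+ (toℕ j ℕ.+ toℕ j)))     ≡⟨ cong (λ x → suc x ℕ.+ (toℕ j ℕ.+ toℕ j)) (sym (ℕP.+-suc K K)) ⟩
        (suc K ℕ.+ suc K) ℕ.+ (toℕ j ℕ.+ toℕ j)         ≡⟨ cong (λ x → (suc x ℕ.+ suc x) ℕ.+ (toℕ j ℕ.+ toℕ j))
                                                              (FinP.toℕ-inject₁ k) ⟩
        (toℕ (suc k) ℕ.+ toℕ (suc k)) ℕ.+ (toℕ j ℕ.+ toℕ j)  ∎)
      where
      open ≡-Reasoning
      K = toℕ (inject₁ k)

  -- By twiceInv-evalWord these words are reduced.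
  reducedWord : (t : Refl (suc (suc m))) →
                Σ[ ws ∈ List F ] (IsWord (reflPerm t) ws × twiceInv ⟦ reflPerm t ⟧ ≡ + 2 * + length ws)
  reducedWord (sR i j i<j) = exact (word-sPerm d j≡i+1+d)
    where
    d = toℕ j ℕ.∸ suc (toℕ i)
    j≡i+1+d : toℕ j ≡ toℕ i ℕ.+ suc d
    j≡i+1+d = trans (sym (ℕP.m+[n∸m]≡n i<j)) (sym (ℕP.+-suc (toℕ i) d))
    arithmetic : ∀ k d → + 2 * (+ 2 * ((k + (+ 1 + d)) - (+ 1 + k)) + + 1) ≡ + 2 * (+ 1 + (d + d))
    arithmetic = solve-∀
    exact : Σ[ ws ∈ List F ] (IsWord (sPerm i j) ws × length ws ≡ suc (d ℕ.+ d)) →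
            Σ[ ws ∈ List F ] (IsWord (sPerm i j) ws × twiceInv ⟦ sPerm i j ⟧ ≡ + 2 * + length ws)
    exact (ws , isWord , len) = ws , isWord , (begin
      twiceInv ⟦ sPerm i j ⟧                                ≡⟨ twiceInv-cong (⟦transposition⟧ (FinP.<⇒≢ i<j) false) ⟩
      twiceInv (update₂ ι i j (ι j) (ι i))                  ≡⟨ FromIdentity.twiceInv-swap i<j ⟩
      + 2 * (+ 2 * (+ toℕ j - + suc (toℕ i)) + + 1)         ≡⟨ cong (λ L → + 2 * (+ 2 * (L - + suc (toℕ i)) + + 1))
                                                               (trans (cong +_ j≡i+1+d) (ℤP.pos-+ (toℕ i) (suc d))) ⟩
      + 2 * (+ 2 * ((+ toℕ i + (+ 1 + + d)) - (+ 1 + + toℕ i)) + + 1)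
                                                            ≡⟨ arithmetic (+ toℕ i) (+ d) ⟩
      + 2 * (+ 1 + (+ d + + d))                             ≡⟨ cong (λ n → + 2 * + n) (sym len) ⟩
      + 2 * + length ws                                     ∎)
      where open ≡-Reasoning
  reducedWord (tR i j i<j) = exact (word-tPerm (toℕ i) refl i<j)
    where
    K = + toℕ i
    L = + toℕ j
    arithmetic : ∀ k l → + 2 * (+ 2 * ((l - (+ 1 + k)) + + 2 * k) + + 1) ≡ + 2 * (((k + k) + (l + l)) - + 1)
    arithmetic = solve-∀
    cancel : ∀ w → (+ 1 + w) - + 1 ≡ w
    cancel = solve-∀
    exact : Σ[ ws ∈ List F ] (IsWord (tPerm i j) ws × suc (length ws) ≡ (toℕ i ℕ.+ toℕ i) ℕ.+ (toℕ j ℕ.+ toℕ j)) →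
            Σ[ ws ∈ List F ] (IsWord (tPerm i j) ws × twiceInv ⟦ tPerm i j ⟧ ≡ + 2 * + length ws)
    exact (ws , isWord , len) = ws , isWord , (begin
      twiceInv ⟦ tPerm i j ⟧                                ≡⟨ twiceInv-cong (⟦transposition⟧ (FinP.<⇒≢ i<j) true) ⟩
      twiceInv (update₂ ι i j (- ι j) (- ι i))              ≡⟨ FromIdentity.twiceInv-negSwap i<j ⟩
      + 2 * (+ 2 * ((L - (+ 1 + K)) + + 2 * K) + + 1)       ≡⟨ arithmetic K L ⟩
      + 2 * (((K + K) + (L + L)) - + 1)                     ≡⟨ cong (λ n → + 2 * (n - + 1)) (sym (cong +_ len)) ⟩
      + 2 * ((+ 1 + + length ws) - + 1)                     ≡⟨ cong (+ 2 *_) (cancel (+ length ws)) ⟩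
      + 2 * + length ws                                     ∎)
      where open ≡-Reasoning

  twiceInv-generator : (w : SPerm (suc (suc m))) (g : F) → twiceInv ⟦ w · simpleGen g ⟧ ℤ.≤ twiceInv ⟦ w ⟧ + + 2
  twiceInv-generator w zero =
    subst (ℤ._≤ twiceInv ⟦ w ⟧ + + 2) (sym (twiceInv-cong (⟦·transposition⟧ {k = zero} {suc zero} (λ ()) w true)))
          (NegSwap.twiceInv-≤ ℕ.z<s ⟦ w ⟧ (λ ()) (λ 0<a a<1 → ℕP.<⇒≱ 0<a (ℕ.s≤s⁻¹ a<1)))
  twiceInv-generator w (suc k) =
    subst (ℤ._≤ twiceInv ⟦ w ⟧ + + 2) (sym (twiceInv-cong (⟦·transposition⟧ (inject₁≢suc k) w false)))
          (Swap.twiceInv-≤ (inject₁<suc k) ⟦ w ⟧ λ k<a a<1+k →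
            ℕP.<⇒≱ (subst (ℕ._< _) (FinP.toℕ-inject₁ k) k<a) (ℕ.s≤s⁻¹ a<1+k))

  twiceInv-word : (w : SPerm (suc (suc m))) (ws : List F) →
                  twiceInv ⟦ w · evalWord ws ⟧ ℤ.≤ twiceInv ⟦ w ⟧ + + 2 * + length ws
  twiceInv-word w [] =
    ℤP.≤-reflexive (trans (cong (twiceInv ∘ ⟦_⟧) (·-identityʳ w)) (sym (ℤP.+-identityʳ _)))
  twiceInv-word w (g ∷ ws) = begin
    twiceInv ⟦ w · (simpleGen g · evalWord ws) ⟧              ≡⟨ cong (twiceInv ∘ ⟦_⟧) (sym (·-assoc w (simpleGen g) (evalWord ws))) ⟩
    twiceInv ⟦ (w · simpleGen g) · evalWord ws ⟧              ≤⟨ twiceInv-word (w · simpleGen g) ws ⟩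
    twiceInv ⟦ w · simpleGen g ⟧ + + 2 * + length ws          ≤⟨ ℤP.+-monoˡ-≤ _ (twiceInv-generator w g) ⟩
    twiceInv ⟦ w ⟧ + + 2 + + 2 * + length ws                  ≡⟨ regroup (twiceInv ⟦ w ⟧) (+ length ws) ⟩
    twiceInv ⟦ w ⟧ + + 2 * (+ 1 + + length ws)                ∎
    where
    open ℤP.≤-Reasoning
    regroup : ∀ t l → t + + 2 + + 2 * l ≡ t + + 2 * (+ 1 + l)
    regroup = solve-∀

  twiceInv-evalWord : (ws : List F) → twiceInv ⟦ evalWord ws ⟧ ℤ.≤ + 2 * + length ws
  twiceInv-evalWord ws = subst₂ ℤ._≤_ (cong (twiceInv ∘ ⟦_⟧) (·-identityˡ (evalWord ws)))
    (trans (cong (_+ + 2 * + length ws) (trans (twiceInv-cong (⟦idP⟧ {suc (suc m)})) (twiceInv-ι {suc (suc m)})))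
           (ℤP.+-identityˡ _))
    (twiceInv-word idP ws)

  -- Ascents and the classification of reflections

  IsAscent : Refl (suc (suc m)) → Refl (suc (suc m)) → Set
  IsAscent t (sR k l _) = ⟦ reflPerm t ⟧ k ℤ.< ⟦ reflPerm t ⟧ l
  IsAscent t (tR k l _) = + 0 ℤ.< ⟦ reflPerm t ⟧ k + ⟦ reflPerm t ⟧ l

  twiceInv-ascent : ∀ t r → IsAscent t r → twiceInv ⟦ reflPerm t ⟧ + + 2 ℤ.≤ twiceInv ⟦ reflPerm t · reflPerm r ⟧
  twiceInv-ascent t (sR k l k<l) ascent =
    subst (twiceInv ⟦ reflPerm t ⟧ + + 2 ℤ.≤_)
          (sym (twiceInv-cong (⟦·transposition⟧ (FinP.<⇒≢ k<l) (reflPerm t) false)))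
          (Swap.twiceInv-≥ k<l ⟦ reflPerm t ⟧ ascent)
  twiceInv-ascent t (tR k l k<l) ascent =
    subst (twiceInv ⟦ reflPerm t ⟧ + + 2 ℤ.≤_)
          (sym (twiceInv-cong (⟦·transposition⟧ (FinP.<⇒≢ k<l) (reflPerm t) true)))
          (NegSwap.twiceInv-≥ k<l ⟦ reflPerm t ⟧ ascent)

  <B⇒LengthLt : {u w : SPerm (suc (suc m))} → u <B w → LengthLt u w
  <B⇒LengthLt Transitive.[ step _ _ u<w ]            = u<w
  <B⇒LengthLt (step _ _ u<v Transitive.∷ v<w) ws isWord with <B⇒LengthLt v<w ws isWord
  ... | vs , isWordᵥ , |vs|<|ws| with u<v vs isWordᵥ
  ...   | us , isWordᵤ , |us|<|vs| = us , isWordᵤ , ℕP.<-trans |us|<|vs| |vs|<|ws|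

  -- With a reduced word ws of t, a shorter word us of t r gives 2|ws| + 2 ≤ twiceInv ⟦ t r ⟧ ≤ 2|us| < 2|ws| + 2.
  descent-not-ascent : ∀ t r → InD t r → ¬ IsAscent t r
  descent-not-ascent t r tr<t ascent with reducedWord t
  ... | ws , isWord , twiceInv≡ with <B⇒LengthLt tr<t ws isWord
  ...   | us , isWordᵤ , |us|<|ws| = ℕP.<-irrefl refl (ℕP.<-≤-trans 2|us|<2|ws|+2 2|ws|+2≤2|us|)
    where
    2|ws|+2≤2|us| : 2 ℕ.* length ws ℕ.+ 2 ℕ.≤ 2 ℕ.* length us
    2|ws|+2≤2|us| = ℤP.drop‿+≤+ (begin
      + (2 ℕ.* length ws) + + 2       ≡⟨ cong (_+ + 2) (trans (ℤP.pos-* 2 (length ws)) (sym twiceInv≡)) ⟩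
      twiceInv ⟦ reflPerm t ⟧ + + 2   ≤⟨ twiceInv-ascent t r ascent ⟩
      twiceInv ⟦ reflPerm t · reflPerm r ⟧
                                      ≡⟨ cong (twiceInv ∘ ⟦_⟧) (sym isWordᵤ) ⟩
      twiceInv ⟦ evalWord us ⟧        ≤⟨ twiceInv-evalWord us ⟩
      + 2 * + length us               ≡⟨ sym (ℤP.pos-* 2 (length us)) ⟩
      + (2 ℕ.* length us)             ∎)
      where open ℤP.≤-Reasoning
    2|us|<2|ws|+2 : 2 ℕ.* length us ℕ.< 2 ℕ.* length ws ℕ.+ 2
    2|us|<2|ws|+2 = ℕP.≤-<-trans (ℕP.*-monoʳ-≤ 2 (ℕP.<⇒≤ |us|<|ws|)) (ℕP.m<m+n _ ℕ.z<s)

  module Window {c : Bool} {i j : F} (i<j : i Fin.< j) where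

    private
      i≢j = FinP.<⇒≢ i<j

    W : F → ℤ
    W = ⟦ transposition c i j ⟧

    W-i : W i ≡ negateIf c (ι j)
    W-i = trans (⟦transposition⟧ i≢j c i) (update₂-left i≢j)

    W-j : W j ≡ negateIf c (ι i)
    W-j = trans (⟦transposition⟧ i≢j c j) (update₂-right i≢j)

    W-other : ∀ {a} → a ≢ i → a ≢ j → W a ≡ ι a
    W-other {a} a≢i a≢j = trans (⟦transposition⟧ i≢j c a) (update₂-outside i≢j a≢i a≢j)

  module sWindow {i j : F} (i<j : i Fin.< j) where

    open Window {false} i<j public

    W≤ι : ∀ {a} → a ≢ i → W a ℤ.≤ ι a
    W≤ι {a} a≢i with a ≟ j
    ... | yes refl = ℤP.≤-trans (ℤP.≤-reflexive W-j) (ℤP.<⇒≤ (ι-mono i<j))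
    ... | no a≢j   = ℤP.≤-reflexive (W-other a≢i a≢j)

    ι≤W : ∀ {a} → a ≢ j → ι a ℤ.≤ W a
    ι≤W {a} a≢j with a ≟ i
    ... | yes refl = ℤP.≤-trans (ℤP.<⇒≤ (ι-mono i<j)) (ℤP.≤-reflexive (sym W-i))
    ... | no a≢i   = ℤP.≤-reflexive (sym (W-other a≢i a≢j))

    W-pos : ∀ a → + 0 ℤ.< W a
    W-pos a with a ≟ i | a ≟ j
    ... | yes refl | _        = subst (+ 0 ℤ.<_) (sym W-i) (+<+ ℕ.z<s)
    ... | no _     | yes refl = subst (+ 0 ℤ.<_) (sym W-j) (+<+ ℕ.z<s)
    ... | no a≢i   | no a≢j   = subst (+ 0 ℤ.<_) (sym (W-other a≢i a≢j)) (+<+ ℕ.z<s)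

  module tWindow {i j : F} (i<j : i Fin.< j) where

    open Window {true} i<j public

    W≤ι : ∀ a → W a ℤ.≤ ι a
    W≤ι a with a ≟ i | a ≟ j
    ... | yes refl | _        = subst (ℤ._≤ ι a) (sym W-i) -≤+
    ... | no _     | yes refl = subst (ℤ._≤ ι a) (sym W-j) -≤+
    ... | no a≢i   | no a≢j   = ℤP.≤-reflexive (W-other a≢i a≢j)

  Outcome : Refl (suc (suc m)) → Refl (suc (suc m)) → Set
  Outcome t r = r ≺ t ⊎ IsAscent t r

  private
    descent : ∀ {t r : Refl (suc (suc m))} {v : V} →
              (∀ x → root t x - root r x ≡ v x) → NonnegSimple v → r ≢ t → Outcome t r
    descent diff nonneg r≢t = inj₁ (nonneg-cong (λ x → sym (diff x)) nonneg , r≢t)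

    -0<+ : ∀ {a b : F} → a Fin.< b → + 0 ℤ.< - ι a + ι b
    -0<+ {a} {b} a<b = subst (+ 0 ℤ.<_) (ℤP.+-comm (ι b) (- ι a)) (m<n⇒0<n-m (ι-mono a<b))

  classify-ss : ∀ {i j k l : F} (p : i Fin.< j) (q : k Fin.< l) → sR k l q ≢ sR i j p → Outcome (sR i j p) (sR k l q)
  classify-ss {i} {j} {k} {l} p q r≢t with k ≟ i | l ≟ j
  ... | yes refl | yes refl = ⊥-elim (r≢t (cong (sR k l) (FinP.<-irrelevant q p)))
  ... | yes refl | no l≢j   = by-l (FinP.<-cmp l j)
    where
    open sWindow p
    cancel : ∀ a b c → (a - b) - (a - c) ≡ c - b
    cancel = solve-∀
    by-l : Tri (l Fin.< j) (l ≡ j) (j Fin.< l) → Outcome (sR i j p) (sR k l q)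
    by-l (tri< l<j _ _) = descent (λ x → cancel (e i x) (e j x) (e l x)) (nonneg-sRoot l<j) r≢t
    by-l (tri≈ _ l≡j _) = ⊥-elim (l≢j l≡j)
    by-l (tri> _ _ j<l) = inj₂ (subst₂ ℤ._<_ (sym W-i) (sym (W-other (≢-sym (FinP.<⇒≢ q)) l≢j)) (ι-mono j<l))
  ... | no k≢i   | yes refl = by-k (FinP.<-cmp k i)
    where
    open sWindow p
    cancel : ∀ a b c → (a - b) - (c - b) ≡ a - c
    cancel = solve-∀
    by-k : Tri (k Fin.< i) (k ≡ i) (i Fin.< k) → Outcome (sR i j p) (sR k l q)
    by-k (tri< k<i _ _) = inj₂ (subst₂ ℤ._<_ (sym (W-other k≢i (FinP.<⇒≢ q))) (sym W-j) (ι-mono k<i))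
    by-k (tri≈ _ k≡i _) = ⊥-elim (k≢i k≡i)
    by-k (tri> _ _ i<k) = descent (λ x → cancel (e i x) (e j x) (e k x)) (nonneg-sRoot i<k) r≢t
  ... | no k≢i   | no l≢j   = inj₂ (ℤP.≤-<-trans (W≤ι k≢i) (ℤP.<-≤-trans (ι-mono q) (ι≤W l≢j)))
    where open sWindow p

  classify-st : ∀ {i j k l : F} (p : i Fin.< j) (q : k Fin.< l) → Outcome (sR i j p) (tR k l q)
  classify-st {k = k} {l} p q = inj₂ (ℤP.+-mono-< (W-pos k) (W-pos l))
    where open sWindow p

  classify-ts : ∀ {i j k l : F} (p : i Fin.< j) (q : k Fin.< l) → sR k l q ≢ tR i j p → Outcome (tR i j p) (sR k l q)
  classify-ts {i} {j} {k} {l} p q r≢t with l ≟ i | l ≟ j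
  ... | yes refl | _        = descent (λ x → cancel (e i x) (e j x) (e k x)) (nonneg-tRoot (ℕP.<-trans q p)) r≢t
    where
    cancel : ∀ a b c → (- a - b) - (c - a) ≡ - c - b
    cancel = solve-∀
  ... | no _     | yes refl = by-k (FinP.<-cmp k i)
    where
    open tWindow p
    cancel₁ : ∀ a b c → (- a - b) - (c - b) ≡ - c - a
    cancel₁ = solve-∀
    cancel₂ : ∀ a b c → (- a - b) - (c - b) ≡ - a - c
    cancel₂ = solve-∀
    by-k : Tri (k Fin.< i) (k ≡ i) (i Fin.< k) → Outcome (tR i j p) (sR k l q)
    by-k (tri< k<i _ _)  = descent (λ x → cancel₁ (e i x) (e j x) (e k x)) (nonneg-tRoot k<i) r≢t
    by-k (tri≈ _ refl _) = inj₂ (subst₂ ℤ._<_ (sym W-i) (sym W-j) (ℤP.neg-mono-< (ι-mono p)))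
    by-k (tri> _ _ i<k)  = descent (λ x → cancel₂ (e i x) (e j x) (e k x)) (nonneg-tRoot i<k) r≢t
  ... | no l≢i   | no l≢j   = inj₂ (ℤP.≤-<-trans (W≤ι k) (subst (ι k ℤ.<_) (sym (W-other l≢i l≢j)) (ι-mono q)))
    where open tWindow p

  classify-tt : ∀ {i j k l : F} (p : i Fin.< j) (q : k Fin.< l) → tR k l q ≢ tR i j p → Outcome (tR i j p) (tR k l q)
  classify-tt {i} {j} {k} {l} p q r≢t with k ≟ i | l ≟ i | l ≟ j
  ... | yes refl | _        | yes refl = ⊥-elim (r≢t (cong (tR k l) (FinP.<-irrelevant q p)))
  ... | yes refl | _        | no l≢j   = by-l (FinP.<-cmp l j)
    where
    open tWindow p
    cancel : ∀ a b c → (- a - b) - (- a - c) ≡ c - b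
    cancel = solve-∀
    by-l : Tri (l Fin.< j) (l ≡ j) (j Fin.< l) → Outcome (tR i j p) (tR k l q)
    by-l (tri< l<j _ _) = descent (λ x → cancel (e i x) (e j x) (e l x)) (nonneg-sRoot l<j) r≢t
    by-l (tri≈ _ l≡j _) = ⊥-elim (l≢j l≡j)
    by-l (tri> _ _ j<l) = inj₂ (subst₂ (λ u v → + 0 ℤ.< u + v) (sym W-i) (sym (W-other (≢-sym (FinP.<⇒≢ q)) l≢j))
                                       (-0<+ j<l))
  ... | no k≢i   | yes refl | _        =
    descent (λ x → cancel (e i x) (e j x) (e k x)) (nonneg-sRoot (ℕP.<-trans q p)) r≢t
    where
    cancel : ∀ a b c → (- a - b) - (- c - a) ≡ c - b
    cancel = solve-∀
  ... | no k≢i   | no _     | yes refl = by-k (FinP.<-cmp k i)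
    where
    open tWindow p
    cancel : ∀ a b c → (- a - b) - (- c - b) ≡ c - a
    cancel = solve-∀
    by-k : Tri (k Fin.< i) (k ≡ i) (i Fin.< k) → Outcome (tR i j p) (tR k l q)
    by-k (tri< k<i _ _) = descent (λ x → cancel (e i x) (e j x) (e k x)) (nonneg-sRoot k<i) r≢t
    by-k (tri≈ _ k≡i _) = ⊥-elim (k≢i k≡i)
    by-k (tri> _ _ i<k) = inj₂ (subst₂ (λ u v → + 0 ℤ.< u + v) (sym (W-other k≢i (FinP.<⇒≢ q))) (sym W-j)
                                       (m<n⇒0<n-m (ι-mono i<k)))
  ... | no k≢i   | no l≢i   | no l≢j   with k ≟ j
  ...   | yes refl = inj₂ (subst₂ (λ u v → + 0 ℤ.< u + v) (sym W-j) (sym (W-other l≢i l≢j)) (-0<+ (ℕP.<-trans p q)))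
    where open tWindow p
  ...   | no k≢j   = inj₂ (subst₂ (λ u v → + 0 ℤ.< u + v) (sym (W-other k≢i k≢j)) (sym (W-other l≢i l≢j)) (ι+ι-pos k l))
    where open tWindow p

  classify : (t r : Refl (suc (suc m))) → r ≢ t → Outcome t r
  classify (sR i j p) (sR k l q) r≢t = classify-ss p q r≢t
  classify (sR i j p) (tR k l q) _   = classify-st p q
  classify (tR i j p) (sR k l q) r≢t = classify-ts p q r≢t
  classify (tR i j p) (tR k l q) r≢t = classify-tt p q r≢t

corollary3p5 : (m : ℕ) (t r : Refl (suc (suc m))) → InD t r → r ≢ t → r ≺ t
corollary3p5 m t r tr<t r≢t with classify t r r≢t
... | inj₁ r≺t    = r≺t
... | inj₂ ascent = ⊥-elim (descent-not-ascent t r tr<t ascent)
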